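{- For every pattern $\sigma\in S_m$, $$\rho_{\sigma}\geq 1-\frac{1}{m!}-O\left(\frac{m-1}{(m!)^2}\right),$$ where the $O$-term refers to $m\to\infty$ and is uniform in $\sigma$ (i.e. there is a constant $C>0$ such that for all $m$ and all $\sigma\in S_m$, $\rho_\sigma\ge 1-\frac1{m!}-C\frac{m-1}{(m!)^2}$).
   Context: $S_n$ denotes the set of permutations of $\{1,\dots,n\}$. For distinct integers $x_1,\dots,x_k$, $\mathrm{st}(x_1,\dots,x_k)\in S_k$ is the permutation obtained by replacing each entry by its rank among $x_1,\dots,x_k$. A permutation $\pi\in S_n$ contains $\sigma\in S_m$ as a consecutive pattern if $\mathrm{st}(\pi_{i+1},\dots,\pi_{i+m})=\sigma$ for some $0\le i\le n-m$; otherwise it is $\sigma$-avoiding. $\alpha_n(\sigma)$ is the number of $\sigma$-avoiding permutations in $S_n$, and $\rho_\sigma=\lim_{n\to\infty}(\alpha_n(\sigma)/n!)^{1/n}$ (this limit is known to exist). -}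

module Defs where

open import Data.Bool using (Bool; true; false; not; _∧_; _∨_)
open import Data.Nat using (ℕ; zero; suc; _∸_; _<ᵇ_; _≡ᵇ_; _!)
import Data.Nat.Properties as ℕP
open import Data.Nat using (_≤_) renaming (_*_ to _ℕ*_)
open import Data.List using (List; []; _∷_; length; map; filterᵇ; upTo; concatMap; take; drop)
open import Data.Bool.ListAction using (any)
open import Data.Product using (Σ)
open import Data.Integer using (+_)
open import Data.Rational using (ℚ; _/_; _+_; _-_; _*_; 1ℚ; 0ℚ; _<_)

-- Permutations are represented 0-based: an element of S_n is a list of
-- length n whose entries are exactly 0,…,n-1 (i.e. entries < n, no repeats).

words : ℕ → ℕ → List (List ℕ)
words zero    n = [] ∷ []
words (suc k) n = concatMap (λ w → map (λ a → a ∷ w) (upTo n)) (words k n)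

elemᵇ : ℕ → List ℕ → Bool
elemᵇ x []       = false
elemᵇ x (y ∷ ys) = (x ≡ᵇ y) ∨ elemᵇ x ys

distinctᵇ : List ℕ → Bool
distinctᵇ []       = true
distinctᵇ (x ∷ xs) = not (elemᵇ x xs) ∧ distinctᵇ xs

S : ℕ → List (List ℕ)
S n = filterᵇ distinctᵇ (words n n)

eqListᵇ : List ℕ → List ℕ → Bool
eqListᵇ []       []       = true
eqListᵇ (x ∷ xs) (y ∷ ys) = (x ≡ᵇ y) ∧ eqListᵇ xs ys
eqListᵇ _        _        = false

st : List ℕ → List ℕ
st xs = map (λ x → length (filterᵇ (λ y → y <ᵇ x) xs)) xs

-- π contains σ consecutively: st(π_{i+1},…,π_{i+m}) = σ for some i.
-- (Windows with i+m > n are shorter than m, hence never equal σ.)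
containsᵇ : List ℕ → List ℕ → Bool
containsᵇ σ π = any (λ i → eqListᵇ (st (take (length σ) (drop i π))) σ) (upTo (suc (length π)))

α : ℕ → List ℕ → ℕ
α n σ = length (filterᵇ (λ π → not (containsᵇ σ π)) (S n))

ℕ→ℚ : ℕ → ℚ
ℕ→ℚ k = (+ k) / 1

_^ℚ_ : ℚ → ℕ → ℚ
q ^ℚ zero  = 1ℚ
q ^ℚ suc n = q * (q ^ℚ n)

bound : ℚ → ℕ → ℚ
bound C m = 1ℚ - ((+ 1) / (m !)) {{ℕP._!≢0 m}}
               - C * ((+ (m ∸ 1)) / (m ! ℕ* m !)) {{ℕP._!*_!≢0 m m}}

-- "ρ_σ ≥ r", where ρ_σ = lim (α_n(σ)/n!)^{1/n}: for every rational q with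
-- 0 < q < r, eventually (α_n(σ)/n!)^{1/n} > q, i.e. q^n · n! < α_n(σ).
ρ≥ : List ℕ → ℚ → Set
ρ≥ σ r = ∀ (q : ℚ) → 0ℚ < q → q < r →
           Σ ℕ (λ N → ∀ n → N ≤ n → (q ^ℚ n) * ℕ→ℚ (n !) < ℕ→ℚ (α n σ))

module Submission where

-- Fix σ ∈ S_m with m ≥ 4 (for m ≤ 3 the bound is not positive). Let a_k count the
-- distinct σ-avoiding words of length k over an alphabet of N letters; α_N(σ) = a_N.
-- Appending a fresh first letter gives a_{k+1} + b_k = (N-k) a_k, where b_k counts the
-- extensions that begin with an occurrence of σ. Such an extension splits as v ++ t with
-- t avoiding of length j = k+1-m and v one of at most C(N-j, m) words with pattern σ,
-- so m! b_k ≤ (N-j)_m a_j. For e_k = a_k (N-k)! this gives e_{k+1} = e_k for k+1 < m and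
-- m! e_k ≤ m! e_{k+1} + e_j otherwise. A growth lemma then shows x e_k ≤ e_{k+1} for any
-- 0 < x ≤ 1 with 1 ≤ m! x^{m-1} (1-x), whence α_N(σ) = e_N ≥ x^N N!. Finally, by Bernoulli's
-- inequality every x in [1 - 4/m!, 1 - 1/m! - 16(m-1)/(m!)^2] qualifies, so C = 16 works.

module Booleans where

  open import Data.Bool using (Bool; true; false; not; _∧_; _∨_)
  open import Data.Nat using (ℕ; zero; suc; _+_; _<ᵇ_; _≡ᵇ_; _<_; _≤_; z≤n; s≤s)
  open import Relation.Binary.PropositionalEquality
  open import Data.Product using (_×_; _,_)
  open import Data.Empty using (⊥-elim)
  open import Data.Bool.Properties using (T-≡)
  open import Data.Nat.Properties using (≡⇒≡ᵇ; ≡ᵇ⇒≡; <⇒<ᵇ; <ᵇ⇒<)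
  open import Function.Bundles using (Equivalence)

  ι : Bool → ℕ
  ι true  = 1
  ι false = 0

  ι≤1 : ∀ b → ι b ≤ 1
  ι≤1 true  = s≤s z≤n
  ι≤1 false = z≤n

  ι-not : ∀ b → ι (not b) + ι b ≡ 1
  ι-not true  = refl
  ι-not false = refl

  ∧-trueˡ : ∀ {a b} → a ∧ b ≡ true → a ≡ true
  ∧-trueˡ {true} _ = refl

  ∧-trueʳ : ∀ {a b} → a ∧ b ≡ true → b ≡ true
  ∧-trueʳ {true} e = e

  ∧-true : ∀ {a b} → a ≡ true → b ≡ true → a ∧ b ≡ true
  ∧-true refl refl = refl

  ∨-false : ∀ {a b} → a ∨ b ≡ false → (a ≡ false) × (b ≡ false)
  ∨-false {false} {false} _ = refl , refl

  not-true : ∀ {a} → not a ≡ true → a ≡ false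
  not-true {false} _ = refl

  not-false : ∀ {a} → a ≡ false → not a ≡ true
  not-false refl = refl

  ∧-swap : ∀ a b c → a ∧ (b ∧ c) ≡ b ∧ (a ∧ c)
  ∧-swap true  b     c = refl
  ∧-swap false true  c = refl
  ∧-swap false false c = refl

  ∨-swap : ∀ a b c → a ∨ (b ∨ c) ≡ b ∨ (a ∨ c)
  ∨-swap true  true  c = refl
  ∨-swap true  false c = refl
  ∨-swap false true  c = refl
  ∨-swap false false c = refl

  ≡ᵇ-refl : ∀ n → (n ≡ᵇ n) ≡ true
  ≡ᵇ-refl n = Equivalence.to T-≡ (≡⇒≡ᵇ n n refl)

  ≡ᵇ-sym : ∀ m n → (m ≡ᵇ n) ≡ (n ≡ᵇ m)
  ≡ᵇ-sym zero    zero    = refl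
  ≡ᵇ-sym zero    (suc n) = refl
  ≡ᵇ-sym (suc m) zero    = refl
  ≡ᵇ-sym (suc m) (suc n) = ≡ᵇ-sym m n

  ≡ᵇ-sound : ∀ m n → (m ≡ᵇ n) ≡ true → m ≡ n
  ≡ᵇ-sound m n e = ≡ᵇ⇒≡ m n (Equivalence.from T-≡ e)

  ≡ᵇ-false : ∀ m n → (m ≡ᵇ n) ≡ false → m ≢ n
  ≡ᵇ-false m .m e refl with trans (sym (≡ᵇ-refl m)) e
  ... | ()

  ≢⇒≡ᵇ-false : ∀ m n → m ≢ n → (m ≡ᵇ n) ≡ false
  ≢⇒≡ᵇ-false zero    zero    ne = ⊥-elim (ne refl)
  ≢⇒≡ᵇ-false zero    (suc n) _  = refl
  ≢⇒≡ᵇ-false (suc m) zero    _  = refl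
  ≢⇒≡ᵇ-false (suc m) (suc n) ne = ≢⇒≡ᵇ-false m n (λ e → ne (cong suc e))

  <⇒<ᵇ-true : ∀ {m n} → m < n → (m <ᵇ n) ≡ true
  <⇒<ᵇ-true m<n = Equivalence.to T-≡ (<⇒<ᵇ m<n)

  ≥⇒<ᵇ-false : ∀ {m n} → n ≤ m → (m <ᵇ n) ≡ false
  ≥⇒<ᵇ-false {m}     {zero}  _       = refl
  ≥⇒<ᵇ-false {suc m} {suc n} (s≤s p) = ≥⇒<ᵇ-false p

  <ᵇ-sound : ∀ m n → (m <ᵇ n) ≡ true → m < n
  <ᵇ-sound m n e = <ᵇ⇒< m n (Equivalence.from T-≡ e)

  <ᵇ-suc : ∀ a n → a ≢ n → (a <ᵇ suc n) ≡ (a <ᵇ n)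
  <ᵇ-suc zero    zero    ne = ⊥-elim (ne refl)
  <ᵇ-suc zero    (suc n) _  = refl
  <ᵇ-suc (suc a) zero    _  = refl
  <ᵇ-suc (suc a) (suc n) ne = <ᵇ-suc a n (λ e → ne (cong suc e))

module FiniteSums where

  open Booleans
  open import Data.Bool using (Bool; true; false)
  open import Data.Nat using (ℕ; zero; suc; _+_; _*_; _≡ᵇ_; _≤_; _<_; z≤n)
  open import Data.Nat.Properties
  open import Data.List using (List; []; _∷_; _++_; length; map; filterᵇ; upTo; applyUpTo; concatMap)
  open import Data.List.Relation.Unary.All using (All; []; _∷_)
  open import Relation.Binary.PropositionalEquality
  open import Relation.Nullary using (yes; no)
  open import Function using (_∘_; id)
  open import Data.List.Properties using (map-upTo)
  open import Data.Nat.Tactic.RingSolver using (solve-∀)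

  Σl : {A : Set} → (A → ℕ) → List A → ℕ
  Σl f []       = 0
  Σl f (x ∷ xs) = f x + Σl f xs

  module _ {A : Set} where

    Σl-++ : (f : A → ℕ) (xs ys : List A) → Σl f (xs ++ ys) ≡ Σl f xs + Σl f ys
    Σl-++ f []       ys = refl
    Σl-++ f (x ∷ xs) ys = trans (cong (f x +_) (Σl-++ f xs ys)) (sym (+-assoc (f x) _ _))

    Σl-cong : {f g : A → ℕ} (xs : List A) → (∀ x → f x ≡ g x) → Σl f xs ≡ Σl g xs
    Σl-cong []       e = refl
    Σl-cong (x ∷ xs) e = cong₂ _+_ (e x) (Σl-cong xs e)

    Σl-cong-All : {P : A → Set} {f g : A → ℕ} {xs : List A} →
                  All P xs → (∀ x → P x → f x ≡ g x) → Σl f xs ≡ Σl g xs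
    Σl-cong-All []                 e = refl
    Σl-cong-All {xs = x ∷ _} (p ∷ ps) e = cong₂ _+_ (e x p) (Σl-cong-All ps e)

    Σl-mono-All : {P : A → Set} {f g : A → ℕ} {xs : List A} →
                  All P xs → (∀ x → P x → f x ≤ g x) → Σl f xs ≤ Σl g xs
    Σl-mono-All []                 e = z≤n
    Σl-mono-All {xs = x ∷ _} (p ∷ ps) e = +-mono-≤ (e x p) (Σl-mono-All ps e)

    Σl-mono : {f g : A → ℕ} (xs : List A) → (∀ x → f x ≤ g x) → Σl f xs ≤ Σl g xs
    Σl-mono []       e = z≤n
    Σl-mono (x ∷ xs) e = +-mono-≤ (e x) (Σl-mono xs e)

    Σl-+ : (f g : A → ℕ) (xs : List A) → Σl (λ x → f x + g x) xs ≡ Σl f xs + Σl g xs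
    Σl-+ f g []       = refl
    Σl-+ f g (x ∷ xs) = trans (cong (f x + g x +_) (Σl-+ f g xs))
                              (interchange (f x) (g x) (Σl f xs) (Σl g xs))
      where
      interchange : ∀ a b c d → (a + b) + (c + d) ≡ (a + c) + (b + d)
      interchange = solve-∀

    Σl-* : (c : ℕ) (f : A → ℕ) (xs : List A) → Σl (λ x → c * f x) xs ≡ c * Σl f xs
    Σl-* c f []       = sym (*-zeroʳ c)
    Σl-* c f (x ∷ xs) = trans (cong (c * f x +_) (Σl-* c f xs)) (sym (*-distribˡ-+ c (f x) (Σl f xs)))

    Σl-0 : (xs : List A) → Σl (λ _ → 0) xs ≡ 0
    Σl-0 []       = refl
    Σl-0 (x ∷ xs) = Σl-0 xs

    length-filter : (p : A → Bool) (xs : List A) → length (filterᵇ p xs) ≡ Σl (ι ∘ p) xs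
    length-filter p []       = refl
    length-filter p (x ∷ xs) with p x
    ... | true  = cong suc (length-filter p xs)
    ... | false = length-filter p xs

  module _ {A B : Set} where

    Σl-map : (f : B → ℕ) (g : A → B) (xs : List A) → Σl f (map g xs) ≡ Σl (f ∘ g) xs
    Σl-map f g []       = refl
    Σl-map f g (x ∷ xs) = cong (f (g x) +_) (Σl-map f g xs)

    Σl-concatMap : (f : B → ℕ) (g : A → List B) (xs : List A) →
                   Σl f (concatMap g xs) ≡ Σl (λ x → Σl f (g x)) xs
    Σl-concatMap f g []       = refl
    Σl-concatMap f g (x ∷ xs) =
      trans (Σl-++ f (g x) (concatMap g xs)) (cong (Σl f (g x) +_) (Σl-concatMap f g xs))

    Σl-swap : (f : A → B → ℕ) (xs : List A) (ys : List B) →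
              Σl (λ x → Σl (f x) ys) xs ≡ Σl (λ y → Σl (λ x → f x y) xs) ys
    Σl-swap f []       ys = sym (Σl-0 ys)
    Σl-swap f (x ∷ xs) ys =
      trans (cong (Σl (f x) ys +_) (Σl-swap f xs ys))
            (sym (Σl-+ (f x) (λ y → Σl (λ x' → f x' y) xs) ys))

  Σl-applyUpTo-snoc : (f g : ℕ → ℕ) (n : ℕ) →
                      Σl f (applyUpTo g (suc n)) ≡ Σl f (applyUpTo g n) + f (g n)
  Σl-applyUpTo-snoc f g zero    = +-comm (f (g 0)) 0
  Σl-applyUpTo-snoc f g (suc n) =
    trans (cong (f (g 0) +_) (Σl-applyUpTo-snoc f (g ∘ suc) n)) (sym (+-assoc (f (g 0)) _ _))

  Σl-upTo-snoc : (f : ℕ → ℕ) (n : ℕ) → Σl f (upTo (suc n)) ≡ Σl f (upTo n) + f n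
  Σl-upTo-snoc f = Σl-applyUpTo-snoc f id

  Σl-upTo-suc : (f : ℕ → ℕ) (n : ℕ) → Σl f (upTo (suc n)) ≡ f 0 + Σl (f ∘ suc) (upTo n)
  Σl-upTo-suc f n = cong (f 0 +_) (trans (cong (Σl f) (sym (map-upTo suc n))) (Σl-map f suc (upTo n)))


  Σl-upTo-const : ∀ n → Σl (λ _ → 1) (upTo n) ≡ n
  Σl-upTo-const zero    = refl
  Σl-upTo-const (suc n) = trans (Σl-upTo-snoc (λ _ → 1) n) (trans (cong (_+ 1) (Σl-upTo-const n)) (+-comm n 1))

  module _ (g : ℕ → ℕ) (b : ℕ) where

    picked : ℕ → ℕ
    picked a = ι (a ≡ᵇ b) * g a

    Σl-pick-absent : ∀ n → n ≤ b → Σl picked (upTo n) ≡ 0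
    Σl-pick-absent zero    _   = refl
    Σl-pick-absent (suc n) n<b =
      trans (Σl-upTo-snoc picked n)
            (cong₂ (λ s t → s + ι t * g n) (Σl-pick-absent n (≤-trans (n≤1+n n) n<b))
                                            (≢⇒≡ᵇ-false n b (λ e → <-irrefl e n<b)))

    Σl-pick : ∀ n → b < n → Σl picked (upTo n) ≡ g b
    Σl-pick (suc n) b<1+n with b ≟ n
    ... | yes refl = trans (Σl-upTo-snoc picked b)
                           (trans (cong₂ (λ s t → s + ι t * g b) (Σl-pick-absent b ≤-refl) (≡ᵇ-refl b)) (+-identityʳ (g b)))
    ... | no b≢n   = trans (Σl-upTo-snoc picked n)
                           (trans (cong₂ (λ s t → s + ι t * g n) (Σl-pick n (≤∧≢⇒< (≤-pred b<1+n) b≢n)) (≢⇒≡ᵇ-false n b (b≢n ∘ sym)))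
                                  (+-identityʳ (g b)))

module Words where

  open import Defs using (words)
  open FiniteSums
  open import Data.Nat using (ℕ; zero; suc; _+_; _<_)
  open import Data.Nat.Properties using (+-identityʳ)
  open import Data.List using (List; []; _∷_; _++_; length; map; upTo)
  open import Data.List.Relation.Unary.All using (All; []; _∷_)
  open import Data.List.Relation.Unary.All.Properties using (concat⁺; gmap⁺; all-upTo)
  open import Data.Product using (_×_; _,_; proj₁; proj₂)
  open import Relation.Binary.PropositionalEquality

  IsWord : ℕ → ℕ → List ℕ → Set
  IsWord N k v = (length v ≡ k) × All (_< N) v

  words-IsWord : ∀ k N → All (IsWord N k) (words k N)
  words-IsWord zero    N = (refl , []) ∷ []
  words-IsWord (suc k) N =
    concat⁺ (gmap⁺ (λ w-ok → gmap⁺ (λ a<N → cong suc (proj₁ w-ok) , a<N ∷ proj₂ w-ok) (all-upTo N))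
                   (words-IsWord k N))

  Σl-words-suc : (f : List ℕ → ℕ) (k N : ℕ) →
                 Σl f (words (suc k) N) ≡ Σl (λ w → Σl (λ a → f (a ∷ w)) (upTo N)) (words k N)
  Σl-words-suc f k N =
    trans (Σl-concatMap f (λ w → map (λ a → a ∷ w) (upTo N)) (words k N))
          (Σl-cong (words k N) (λ w → Σl-map f (λ a → a ∷ w) (upTo N)))

  Σl-words-++ : (f : List ℕ → ℕ) (m j N : ℕ) →
                Σl f (words (m + j) N) ≡ Σl (λ t → Σl (λ v → f (v ++ t)) (words m N)) (words j N)
  Σl-words-++ f zero    j N = Σl-cong (words j N) (λ t → sym (+-identityʳ (f t)))
  Σl-words-++ f (suc m) j N =
    trans (Σl-words-suc f (m + j) N)
    (trans (Σl-words-++ (λ w → Σl (λ a → f (a ∷ w)) (upTo N)) m j N)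
           (Σl-cong (words j N) (λ t → sym (Σl-words-suc (λ v → f (v ++ t)) m N))))

module Insertion where

  open import Defs using (words; elemᵇ; distinctᵇ; eqListᵇ; st)
  open Booleans
  open FiniteSums
  open Words
  open import Data.Bool using (Bool; true; false; not; _∧_; _∨_)
  open import Data.Nat using (ℕ; zero; suc; _+_; _*_; _<ᵇ_; _≡ᵇ_; _≤_; _<_; z≤n; s≤s)
  open import Data.Nat.Properties
  open import Data.List using (List; []; _∷_; length; map; filterᵇ; upTo)
  open import Data.List.Relation.Unary.All using (All; []; _∷_)
  open import Data.Product using (_×_; _,_; proj₁; proj₂)
  open import Relation.Binary.PropositionalEquality
  open import Function using (_∘_)
  open import Data.Nat.Tactic.RingSolver using (solve-∀)

  eqAt : ℕ → ℕ → List ℕ → Bool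
  eqAt zero    c (x ∷ _)  = x ≡ᵇ c
  eqAt (suc i) c (_ ∷ xs) = eqAt i c xs
  eqAt _       _ []       = false

  insertAt : ℕ → ℕ → List ℕ → List ℕ
  insertAt zero    c v        = c ∷ v
  insertAt (suc i) c []       = c ∷ []
  insertAt (suc i) c (y ∷ ys) = y ∷ insertAt i c ys

  deleteAt : ℕ → List ℕ → List ℕ
  deleteAt _       []       = []
  deleteAt zero    (x ∷ xs) = xs
  deleteAt (suc i) (x ∷ xs) = x ∷ deleteAt i xs

  allᵇ : (ℕ → Bool) → List ℕ → Bool
  allᵇ p []       = true
  allᵇ p (x ∷ xs) = p x ∧ allᵇ p xs

  Σl-words-at : (c N : ℕ) → c < N → (i m : ℕ) → i ≤ m → (f : List ℕ → ℕ) →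
                Σl (λ v → ι (eqAt i c v) * f v) (words (suc m) N) ≡ Σl (λ v → f (insertAt i c v)) (words m N)
  Σl-words-at c N c<N zero m _ f =
    trans (Σl-words-suc (λ v → ι (eqAt 0 c v) * f v) m N)
          (Σl-cong (words m N) (λ w → Σl-pick (λ a → f (a ∷ w)) c N c<N))
  Σl-words-at c N c<N (suc i) (suc m) (s≤s i≤m) f =
    trans (Σl-words-suc (λ v → ι (eqAt (suc i) c v) * f v) (suc m) N)
    (trans (Σl-swap (λ w a → ι (eqAt i c w) * f (a ∷ w)) (words (suc m) N) (upTo N))
    (trans (Σl-cong (upTo N) (λ a → Σl-words-at c N c<N i m i≤m (λ w → f (a ∷ w))))
    (trans (sym (Σl-swap (λ w a → f (a ∷ insertAt i c w)) (words m N) (upTo N)))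
           (sym (Σl-words-suc (λ v → f (insertAt (suc i) c v)) m N)))))

  Σl-insertAt : (f : ℕ → ℕ) (i c : ℕ) (v : List ℕ) → Σl f (insertAt i c v) ≡ f c + Σl f v
  Σl-insertAt f zero    c v        = refl
  Σl-insertAt f (suc i) c []       = refl
  Σl-insertAt f (suc i) c (y ∷ ys) = trans (cong (f y +_) (Σl-insertAt f i c ys)) (swap (f y) (f c) (Σl f ys))
    where
    swap : ∀ a b s → a + (b + s) ≡ b + (a + s)
    swap = solve-∀

  map-insertAt : (f : ℕ → ℕ) (i c : ℕ) (v : List ℕ) → map f (insertAt i c v) ≡ insertAt i (f c) (map f v)
  map-insertAt f zero    c v        = refl
  map-insertAt f (suc i) c []       = refl
  map-insertAt f (suc i) c (y ∷ ys) = cong (f y ∷_) (map-insertAt f i c ys)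

  elem-insertAt : (x i c : ℕ) (v : List ℕ) → elemᵇ x (insertAt i c v) ≡ (x ≡ᵇ c) ∨ elemᵇ x v
  elem-insertAt x zero    c v        = refl
  elem-insertAt x (suc i) c []       = refl
  elem-insertAt x (suc i) c (y ∷ ys) =
    trans (cong ((x ≡ᵇ y) ∨_) (elem-insertAt x i c ys)) (∨-swap (x ≡ᵇ y) (x ≡ᵇ c) (elemᵇ x ys))

  distinct-insertAt : (i c : ℕ) (v : List ℕ) → distinctᵇ (insertAt i c v) ≡ not (elemᵇ c v) ∧ distinctᵇ v
  distinct-insertAt zero    c v        = refl
  distinct-insertAt (suc i) c []       = refl
  distinct-insertAt (suc i) c (y ∷ ys)
    rewrite elem-insertAt y i c ys | distinct-insertAt i c ys | ≡ᵇ-sym y c = rearrange (c ≡ᵇ y) (elemᵇ y ys) (elemᵇ c ys) (distinctᵇ ys)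
    where
    rearrange : ∀ a b c d → not (a ∨ b) ∧ (not c ∧ d) ≡ not (a ∨ c) ∧ (not b ∧ d)
    rearrange true  b     c     d = refl
    rearrange false true  true  d = refl
    rearrange false true  false d = refl
    rearrange false false true  d = refl
    rearrange false false false d = refl

  allᵇ-insertAt : (p : ℕ → Bool) (i c : ℕ) (v : List ℕ) → allᵇ p (insertAt i c v) ≡ p c ∧ allᵇ p v
  allᵇ-insertAt p zero    c v        = refl
  allᵇ-insertAt p (suc i) c []       = refl
  allᵇ-insertAt p (suc i) c (y ∷ ys) = trans (cong (p y ∧_) (allᵇ-insertAt p i c ys)) (∧-swap (p y) (p c) (allᵇ p ys))

  rank : ℕ → List ℕ → ℕ
  rank x v = length (filterᵇ (λ y → y <ᵇ x) v)

  rank-insertAt : (x i c : ℕ) (v : List ℕ) → rank x (insertAt i c v) ≡ ι (c <ᵇ x) + rank x v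
  rank-insertAt x i c v =
    trans (length-filter (λ y → y <ᵇ x) (insertAt i c v))
    (trans (Σl-insertAt (ι ∘ (λ y → y <ᵇ x)) i c v) (cong (ι (c <ᵇ x) +_) (sym (length-filter (λ y → y <ᵇ x) v))))

  rank-above : (c : ℕ) (v : List ℕ) → All (_< c) v → rank c v ≡ length v
  rank-above c []       []         = refl
  rank-above c (y ∷ ys) (y<c ∷ ps) rewrite <⇒<ᵇ-true y<c = cong suc (rank-above c ys ps)

  st-insertAt-max : (i c : ℕ) (v : List ℕ) → All (_< c) v → st (insertAt i c v) ≡ insertAt i (length v) (st v)
  st-insertAt-max i c v v<c =
    trans (map-insertAt (λ x → rank x (insertAt i c v)) i c v)
          (cong₂ (insertAt i) rank-c (map-cong-All v<c))
    where
    rank-c : rank c (insertAt i c v) ≡ length v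
    rank-c = trans (rank-insertAt c i c v)
                   (trans (cong (λ b → ι b + rank c v) (≥⇒<ᵇ-false {c} {c} ≤-refl)) (rank-above c v v<c))
    map-cong-All : {xs : List ℕ} → All (_< c) xs → map (λ x → rank x (insertAt i c v)) xs ≡ map (λ x → rank x v) xs
    map-cong-All []                   = refl
    map-cong-All {x ∷ _} (x<c ∷ ps) =
      cong₂ _∷_ (trans (rank-insertAt x i c v) (cong (λ b → ι b + rank x v) (≥⇒<ᵇ-false (<⇒≤ x<c))))
                (map-cong-All ps)

  eqListᵇ-sound : (xs ys : List ℕ) → eqListᵇ xs ys ≡ true → xs ≡ ys
  eqListᵇ-sound []       []       e = refl
  eqListᵇ-sound (x ∷ xs) (y ∷ ys) e =
    cong₂ _∷_ (≡ᵇ-sound x y (∧-trueˡ e)) (eqListᵇ-sound xs ys (∧-trueʳ {x ≡ᵇ y} e))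

  eqListᵇ-refl : (xs : List ℕ) → eqListᵇ xs xs ≡ true
  eqListᵇ-refl []       = refl
  eqListᵇ-refl (x ∷ xs) rewrite ≡ᵇ-refl x = eqListᵇ-refl xs

  insertAt-inverse : (i c : ℕ) (τ σ : List ℕ) → i ≤ length τ → eqListᵇ (insertAt i c τ) σ ≡ true →
                     (eqAt i c σ ≡ true) × (eqListᵇ τ (deleteAt i σ) ≡ true)
  insertAt-inverse i c τ σ i≤|τ| e with eqListᵇ-sound (insertAt i c τ) σ e
  ... | refl = at i τ i≤|τ| , subst (λ z → eqListᵇ τ z ≡ true) (sym (deleted i τ i≤|τ|)) (eqListᵇ-refl τ)
    where
    at : ∀ i τ → i ≤ length τ → eqAt i c (insertAt i c τ) ≡ true
    at zero    τ        _         = ≡ᵇ-refl c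
    at (suc i) (y ∷ ys) (s≤s i≤) = at i ys i≤
    deleted : ∀ i τ → i ≤ length τ → deleteAt i (insertAt i c τ) ≡ τ
    deleted zero    τ        _         = refl
    deleted (suc i) (y ∷ ys) (s≤s i≤) = cong (y ∷_) (deleted i ys i≤)

  elem-deleteAt : (x i : ℕ) (σ : List ℕ) → elemᵇ x (deleteAt i σ) ≡ true → elemᵇ x σ ≡ true
  elem-deleteAt x i       []       e = e
  elem-deleteAt x zero    (y ∷ ys) e with x ≡ᵇ y
  ... | true  = refl
  ... | false = e
  elem-deleteAt x (suc i) (y ∷ ys) e with x ≡ᵇ y
  ... | true  = refl
  ... | false = elem-deleteAt x i ys e

  distinct-deleteAt : (i : ℕ) (σ : List ℕ) → distinctᵇ σ ≡ true → distinctᵇ (deleteAt i σ) ≡ true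
  distinct-deleteAt i       []       d = d
  distinct-deleteAt zero    (y ∷ ys) d = ∧-trueʳ {not (elemᵇ y ys)} d
  distinct-deleteAt (suc i) (y ∷ ys) d =
    ∧-true (not-false y∉) (distinct-deleteAt i ys (∧-trueʳ {not (elemᵇ y ys)} d))
    where
    y∉ : elemᵇ y (deleteAt i ys) ≡ false
    y∉ with elemᵇ y (deleteAt i ys) in e
    ... | false = refl
    ... | true with trans (sym (elem-deleteAt y i ys e)) (not-true (∧-trueˡ d))
    ...   | ()

  positions : ℕ → List ℕ → ℕ → ℕ
  positions c v n = Σl (λ i → ι (eqAt i c v)) (upTo n)

  positions-absent : (c : ℕ) (v : List ℕ) (n : ℕ) → elemᵇ c v ≡ false → positions c v n ≡ 0
  positions-absent c v n c∉v = trans (Σl-cong (upTo n) (λ i → cong ι (at i v c∉v))) (Σl-0 (upTo n))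
    where
    at : ∀ i v → elemᵇ c v ≡ false → eqAt i c v ≡ false
    at zero    []       _ = refl
    at (suc i) []       _ = refl
    at zero    (y ∷ ys) e = trans (≡ᵇ-sym y c) (proj₁ (∨-false e))
    at (suc i) (y ∷ ys) e = at i ys (proj₂ (∨-false {c ≡ᵇ y} e))

  positions-present : (c : ℕ) (v : List ℕ) → ι (elemᵇ c v) ≤ positions c v (length v)
  positions-present c []       = z≤n
  positions-present c (y ∷ ys) rewrite Σl-upTo-suc (λ i → ι (eqAt i c (y ∷ ys))) (length ys) | ≡ᵇ-sym c y
    with y ≡ᵇ c
  ... | true  = s≤s z≤n
  ... | false = positions-present c ys

  positions-distinct : (c : ℕ) (σ : List ℕ) (n : ℕ) → distinctᵇ σ ≡ true → positions c σ n ≤ 1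
  positions-distinct c []       n       _ = ≤-trans (≤-reflexive (positions-absent c [] n refl)) z≤n
  positions-distinct c (y ∷ ys) zero    _ = z≤n
  positions-distinct c (y ∷ ys) (suc n) d rewrite Σl-upTo-suc (λ i → ι (eqAt i c (y ∷ ys))) n with y ≡ᵇ c in e
  ... | false = positions-distinct c ys n (∧-trueʳ {not (elemᵇ y ys)} d)
  ... | true  rewrite ≡ᵇ-sound y c e | positions-absent c ys n (not-true (∧-trueˡ d)) = s≤s z≤n

module PatternCount where

  open import Defs using (words; elemᵇ; distinctᵇ; eqListᵇ; st)
  open Booleans
  open FiniteSums
  open Words
  open Insertion
  open import Data.Bool using (Bool; true; false; not; _∧_)
  open import Data.Bool.Properties using (∧-zeroʳ)
  open import Data.Nat using (ℕ; zero; suc; _+_; _*_; _∸_; _<ᵇ_; _≡ᵇ_; _!; _≤_; _<_; z≤n)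
  open import Data.Nat.Properties
  open import Data.Nat.Combinatorics.Base using (_P′_)
  open import Data.List using (List; []; _∷_; length; upTo)
  open import Data.List.Properties using (length-map)
  open import Data.List.Relation.Unary.All using (All; []; _∷_)
  open import Data.List.Relation.Unary.All.Properties using (all-upTo)
  open import Data.Product using (_×_; _,_; proj₁; proj₂)
  open import Relation.Binary.PropositionalEquality
  open import Relation.Nullary using (yes; no)
  open import Data.Nat.Tactic.RingSolver using (solve-∀)
  open import Function using (_∘′_)

  ∸-peel : ∀ {s m} → m < s → s ∸ m ≡ suc (s ∸ suc m)
  ∸-peel m<s = +-∸-assoc 1 m<s

  P′-pascal : ∀ s m → suc s P′ suc m ≡ s P′ suc m + suc m * (s P′ m)
  P′-pascal s zero    = base s
    where
    base : ∀ s → suc s * 1 ≡ s * 1 + 1 * 1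
    base = solve-∀
  P′-pascal s (suc m) rewrite P′-pascal s m with m <? s
  ... | yes m<s rewrite ∸-peel m<s = grow (s ∸ suc m) (s P′ m) m
    where
    grow : ∀ b F m → suc b * (suc b * F + suc m * F) ≡ b * (suc b * F) + suc (suc m) * (suc b * F)
    grow = solve-∀
  ... | no m≮s rewrite m≤n⇒m∸n≡0 (≮⇒≥ m≮s) | m≤n⇒m∸n≡0 (≤-trans (≮⇒≥ m≮s) (n≤1+n m)) = vanish (s P′ m) m
    where
    vanish : ∀ F m → 0 * (0 * F + suc m * F) ≡ 0 * (0 * F) + suc (suc m) * (0 * F)
    vanish = solve-∀

  P′-factorial : ∀ s m → m ≤ s → (s P′ m) * (s ∸ m) ! ≡ s !
  P′-factorial s zero    _   = *-identityˡ (s !)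
  P′-factorial s (suc m) m<s = begin
    (s ∸ m) * (s P′ m) * (s ∸ suc m) !   ≡⟨ cong (_* (s ∸ suc m) !) (*-comm (s ∸ m) (s P′ m)) ⟩
    (s P′ m) * (s ∸ m) * (s ∸ suc m) !   ≡⟨ *-assoc (s P′ m) (s ∸ m) ((s ∸ suc m) !) ⟩
    (s P′ m) * ((s ∸ m) * (s ∸ suc m) !) ≡⟨ cong (λ k → (s P′ m) * (k * (s ∸ suc m) !)) (∸-peel m<s) ⟩
    (s P′ m) * (suc (s ∸ suc m) !)       ≡⟨ cong (λ k → (s P′ m) * k !) (sym (∸-peel m<s)) ⟩
    (s P′ m) * (s ∸ m) !                 ≡⟨ P′-factorial s m (<⇒≤ m<s) ⟩
    s !                                  ∎
    where open ≡-Reasoning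

  -- Fix an alphabet bound N and a word t whose letters are forbidden.
  module Fitting (N : ℕ) (t : List ℕ) where

    allowed : ℕ → ℕ → Bool
    allowed B a = (a <ᵇ B) ∧ not (elemᵇ a t)

    fits : ℕ → List ℕ → List ℕ → Bool
    fits B σ v = allᵇ (allowed B) v ∧ (distinctᵇ v ∧ eqListᵇ (st v) σ)

    count : ℕ → ℕ → List ℕ → ℕ
    count B m σ = Σl (λ v → ι (fits B σ v)) (words m N)

    available : ℕ → ℕ
    available B = Σl (λ a → ι (not (elemᵇ a t))) (upTo B)

    allowed-suc : ∀ a B → a ≢ B → allowed (suc B) a ≡ allowed B a
    allowed-suc a B a≢B = cong (_∧ not (elemᵇ a t)) (<ᵇ-suc a B a≢B)

    allowed-lower : ∀ B v → allᵇ (allowed (suc B)) v ≡ true → elemᵇ B v ≡ false → allᵇ (allowed B) v ≡ true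
    allowed-lower B []      _  _ = refl
    allowed-lower B (a ∷ w) ok B∉ with ∨-false {B ≡ᵇ a} B∉
    ... | B≢a , B∉w = ∧-true (trans (sym (allowed-suc a B (≡ᵇ-false B a B≢a ∘′ sym))) (∧-trueˡ ok))
                             (allowed-lower B w (∧-trueʳ {allowed (suc B) a} ok) B∉w)

    allowed-below : ∀ B v → allᵇ (allowed B) v ≡ true → All (_< B) v
    allowed-below B []      _  = []
    allowed-below B (a ∷ w) ok = <ᵇ-sound a B (∧-trueˡ (∧-trueˡ ok)) ∷ allowed-below B w (∧-trueʳ {allowed B a} ok)

    fits-split : ∀ B σ v → ι (fits (suc B) σ v) ≤ ι (fits B σ v) + Σl (λ i → ι (eqAt i B v) * ι (fits (suc B) σ v)) (upTo (length v))
    fits-split B σ v with elemᵇ B v in B∈? | fits (suc B) σ v in fit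
    ... | _     | false = z≤n
    ... | false | true  = ≤-trans (≤-reflexive (cong ι (sym fits-B))) (m≤m+n (ι (fits B σ v)) _)
      where
      fits-B : fits B σ v ≡ true
      fits-B = ∧-true (allowed-lower B v (∧-trueˡ fit) B∈?) (∧-trueʳ {allᵇ (allowed (suc B)) v} fit)
    ... | true  | true  = begin
      1                                                   ≡⟨ cong ι (sym B∈?) ⟩
      ι (elemᵇ B v)                                       ≤⟨ positions-present B v ⟩
      positions B v (length v)                            ≡⟨ Σl-cong (upTo (length v)) (λ i → sym (*-identityʳ (ι (eqAt i B v)))) ⟩
      Σl (λ i → ι (eqAt i B v) * 1) (upTo (length v))     ≤⟨ m≤n+m _ (ι (fits B σ v)) ⟩
      ι (fits B σ v) + Σl (λ i → ι (eqAt i B v) * 1) (upTo (length v)) ∎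
      where open ≤-Reasoning

    fits-insertAt : ∀ B i m' σ v' → i ≤ m' → length v' ≡ m' →
                    ι (fits (suc B) σ (insertAt i B v')) ≤ ι (eqAt i m' σ) * ι (fits B (deleteAt i σ) v')
    fits-insertAt B i m' σ v' i≤m' |v'| with fits (suc B) σ (insertAt i B v') in fit
    ... | false = z≤n
    ... | true  = ≤-reflexive (sym (cong₂ (λ a b → ι a * ι b) (proj₁ inverse)
                                          (∧-true allowed-v' (∧-true (∧-trueʳ {not (elemᵇ B v')} distinct-v') (proj₂ inverse)))))
      where
      allowed-ins : allᵇ (allowed (suc B)) (insertAt i B v') ≡ true
      allowed-ins = ∧-trueˡ fit
      distinct-ins : distinctᵇ (insertAt i B v') ≡ true
      distinct-ins = ∧-trueˡ (∧-trueʳ {allᵇ (allowed (suc B)) (insertAt i B v')} fit)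
      pattern-ins : eqListᵇ (st (insertAt i B v')) σ ≡ true
      pattern-ins = ∧-trueʳ {distinctᵇ (insertAt i B v')} (∧-trueʳ {allᵇ (allowed (suc B)) (insertAt i B v')} fit)
      distinct-v' : not (elemᵇ B v') ∧ distinctᵇ v' ≡ true
      distinct-v' = trans (sym (distinct-insertAt i B v')) distinct-ins
      allowed-v' : allᵇ (allowed B) v' ≡ true
      allowed-v' = allowed-lower B v'
                     (∧-trueʳ {allowed (suc B) B} (trans (sym (allᵇ-insertAt (allowed (suc B)) i B v')) allowed-ins))
                     (not-true (∧-trueˡ distinct-v'))
      pattern-v' : eqListᵇ (insertAt i m' (st v')) σ ≡ true
      pattern-v' = subst (λ z → eqListᵇ z σ ≡ true)
                      (trans (st-insertAt-max i B v' (allowed-below B v' allowed-v')) (cong (λ z → insertAt i z (st v')) |v'|))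
                      pattern-ins
      i≤|st| : i ≤ length (st v')
      i≤|st| = subst (i ≤_) (sym (trans (length-map _ v') |v'|)) i≤m'
      inverse : (eqAt i m' σ ≡ true) × (eqListᵇ (st v') (deleteAt i σ) ≡ true)
      inverse = insertAt-inverse i m' (st v') σ i≤|st| pattern-v'

    count-nothing : ∀ m σ → count 0 (suc m) σ ≡ 0
    count-nothing m σ = trans (Σl-cong-All (words-IsWord (suc m) N) (λ { [] (() , _) ; (a ∷ w) _ → refl }))
                              (Σl-0 (words (suc m) N))

    module _ (B : ℕ) (B∈t : elemᵇ B t ≡ true) where

      count-forbidden : ∀ m σ → count (suc B) m σ ≡ count B m σ
      count-forbidden m σ = Σl-cong (words m N) (λ v → cong (λ z → ι (z ∧ (distinctᵇ v ∧ eqListᵇ (st v) σ))) (allᵇ-cong v))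
        where
        same : ∀ a → allowed (suc B) a ≡ allowed B a
        same a with a ≟ B
        ... | yes refl rewrite B∈t = trans (∧-zeroʳ (a <ᵇ suc a)) (sym (∧-zeroʳ (a <ᵇ a)))
        ... | no a≢B  = allowed-suc a B a≢B
        allᵇ-cong : ∀ v → allᵇ (allowed (suc B)) v ≡ allᵇ (allowed B) v
        allᵇ-cong []      = refl
        allᵇ-cong (a ∷ w) = cong₂ _∧_ (same a) (allᵇ-cong w)

      available-forbidden : available (suc B) ≡ available B
      available-forbidden = trans (Σl-upTo-snoc (λ a → ι (not (elemᵇ a t))) B)
                                  (trans (cong (λ z → available B + ι (not z)) B∈t) (+-identityʳ (available B)))

    -- An allowed letter B: words fitting below B+1 either fit below B or arise by
    -- inserting B, at a position where σ has its top value.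
    module _ (B : ℕ) (B<N : B < N) (B∉t : elemᵇ B t ≡ false) where

      available-allowed : available (suc B) ≡ suc (available B)
      available-allowed = trans (Σl-upTo-snoc (λ a → ι (not (elemᵇ a t))) B)
                                (trans (cong (λ z → available B + ι (not z)) B∉t) (+-comm (available B) 1))

      count-allowed : ∀ m σ → count (suc B) (suc m) σ ≤ count B (suc m) σ + Σl (λ i → ι (eqAt i m σ) * count B m (deleteAt i σ)) (upTo (suc m))
      count-allowed m σ = begin
          count (suc B) (suc m) σ
        ≤⟨ Σl-mono-All (words-IsWord (suc m) N) (λ v w → subst (λ n → ι (fit v) ≤ ι (fits B σ v) + Σl (λ i → at i v) (upTo n)) (proj₁ w) (fits-split B σ v)) ⟩
          Σl (λ v → ι (fits B σ v) + Σl (λ i → at i v) (upTo (suc m))) (words (suc m) N)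
        ≡⟨ Σl-+ (λ v → ι (fits B σ v)) (λ v → Σl (λ i → at i v) (upTo (suc m))) (words (suc m) N) ⟩
          count B (suc m) σ + Σl (λ v → Σl (λ i → at i v) (upTo (suc m))) (words (suc m) N)
        ≡⟨ cong (count B (suc m) σ +_) (Σl-swap (λ v i → at i v) (words (suc m) N) (upTo (suc m))) ⟩
          count B (suc m) σ + Σl (λ i → Σl (λ v → at i v) (words (suc m) N)) (upTo (suc m))
        ≤⟨ +-monoʳ-≤ (count B (suc m) σ) (Σl-mono-All (all-upTo (suc m)) (λ i i<1+m → at-i i (≤-pred i<1+m))) ⟩
          count B (suc m) σ + Σl (λ i → ι (eqAt i m σ) * count B m (deleteAt i σ)) (upTo (suc m)) ∎
        where
        open ≤-Reasoning
        fit : List ℕ → Bool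
        fit = fits (suc B) σ
        at : ℕ → List ℕ → ℕ
        at i v = ι (eqAt i B v) * ι (fit v)
        at-i : ∀ i → i ≤ m → Σl (at i) (words (suc m) N) ≤ ι (eqAt i m σ) * count B m (deleteAt i σ)
        at-i i i≤m = begin
            Σl (at i) (words (suc m) N)
          ≡⟨ Σl-words-at B N B<N i m i≤m (λ v → ι (fit v)) ⟩
            Σl (λ v' → ι (fit (insertAt i B v'))) (words m N)
          ≤⟨ Σl-mono-All (words-IsWord m N) (λ v' w → fits-insertAt B i m σ v' i≤m (proj₁ w)) ⟩
            Σl (λ v' → ι (eqAt i m σ) * ι (fits B (deleteAt i σ) v')) (words m N)
          ≡⟨ Σl-* (ι (eqAt i m σ)) (λ v' → ι (fits B (deleteAt i σ) v')) (words m N) ⟩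
            ι (eqAt i m σ) * count B m (deleteAt i σ) ∎

    -- Bounding the inserted-top-value term: σ (distinct) has its top value at most once.
    deletions-bound : ∀ B m σ K → distinctᵇ σ ≡ true → (∀ i → m ! * count B m (deleteAt i σ) ≤ K) →
                      suc m ! * Σl (λ i → ι (eqAt i m σ) * count B m (deleteAt i σ)) (upTo (suc m)) ≤ suc m * K
    deletions-bound B m σ K distinct bound = begin
        suc m ! * Σl (λ i → e i * c i) (upTo (suc m))
      ≡⟨ sym (Σl-* (suc m !) (λ i → e i * c i) (upTo (suc m))) ⟩
        Σl (λ i → suc m ! * (e i * c i)) (upTo (suc m))
      ≤⟨ Σl-mono (upTo (suc m)) (λ i → ≤-trans (≤-reflexive (regroup (suc m) (m !) (e i) (c i)))
                                               (*-monoʳ-≤ (e i) (*-monoʳ-≤ (suc m) (bound i)))) ⟩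
        Σl (λ i → e i * (suc m * K)) (upTo (suc m))
      ≡⟨ Σl-cong (upTo (suc m)) (λ i → *-comm (e i) (suc m * K)) ⟩
        Σl (λ i → suc m * K * e i) (upTo (suc m))
      ≡⟨ Σl-* (suc m * K) e (upTo (suc m)) ⟩
        suc m * K * positions m σ (suc m)
      ≤⟨ *-monoʳ-≤ (suc m * K) (positions-distinct m σ (suc m) distinct) ⟩
        suc m * K * 1
      ≡⟨ *-identityʳ (suc m * K) ⟩
        suc m * K ∎
      where
      open ≤-Reasoning
      e : ℕ → ℕ
      e i = ι (eqAt i m σ)
      c : ℕ → ℕ
      c i = count B m (deleteAt i σ)
      regroup : ∀ s f a c → (s * f) * (a * c) ≡ a * (s * (f * c))
      regroup = solve-∀

    -- At most (available B) P′ m / m! = C(available B, m) words of length m fit a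
    -- distinct pattern σ below B: the main counting bound.
    count-bound : ∀ B → B ≤ N → ∀ m σ → distinctᵇ σ ≡ true → m ! * count B m σ ≤ available B P′ m
    count-bound B       _   zero    σ _ = ≤-trans (≤-reflexive (trans (*-identityˡ _) (+-identityʳ _))) (ι≤1 (fits B σ []))
    count-bound zero    _   (suc m) σ _ = ≤-trans (≤-reflexive (trans (cong (suc m ! *_) (count-nothing m σ)) (*-zeroʳ (suc m !)))) z≤n
    count-bound (suc B) B<N (suc m) σ distinct with elemᵇ B t in B∈?
    ... | true  rewrite count-forbidden B B∈? (suc m) σ | available-forbidden B B∈? =
      count-bound B (<⇒≤ B<N) (suc m) σ distinct
    ... | false = begin
        suc m ! * count (suc B) (suc m) σ
      ≤⟨ *-monoʳ-≤ (suc m !) (count-allowed B B<N B∈? m σ) ⟩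
        suc m ! * (count B (suc m) σ + T)
      ≡⟨ *-distribˡ-+ (suc m !) (count B (suc m) σ) T ⟩
        suc m ! * count B (suc m) σ + suc m ! * T
      ≤⟨ +-mono-≤ (IH (suc m) σ distinct) (deletions-bound B m σ _ distinct (λ i → IH m (deleteAt i σ) (distinct-deleteAt i σ distinct))) ⟩
        available B P′ suc m + suc m * (available B P′ m)
      ≡⟨ sym (P′-pascal (available B) m) ⟩
        suc (available B) P′ suc m
      ≡⟨ cong (_P′ suc m) (sym (available-allowed B B<N B∈?)) ⟩
        available (suc B) P′ suc m ∎
      where
      open ≤-Reasoning
      IH : ∀ m σ → distinctᵇ σ ≡ true → m ! * count B m σ ≤ available B P′ m
      IH = count-bound B (<⇒≤ B<N)
      T : ℕ
      T = Σl (λ i → ι (eqAt i m σ) * count B m (deleteAt i σ)) (upTo (suc m))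

module Recurrence where

  open import Defs using (words; elemᵇ; distinctᵇ; eqListᵇ; st; containsᵇ; α)
  open Booleans
  open FiniteSums
  open Words
  open Insertion
  open PatternCount
  open import Data.Bool using (Bool; true; false; not; _∧_; _∨_)
  open import Data.Bool.Properties using (∨-assoc; ∧-zeroʳ)
  open import Data.Bool.ListAction using (any)
  open import Data.Nat using (ℕ; zero; suc; _+_; _*_; _∸_; _≡ᵇ_; _!; _≤_; _<_; z≤n)
  open import Data.Nat.Properties
  open import Data.Nat.Combinatorics.Base using (_P′_)
  open import Data.List using (List; []; _∷_; _++_; length; map; filterᵇ; upTo; take; drop)
  open import Data.List.Properties using (length-map; take-all; map-upTo)
  open import Data.List.Relation.Unary.All using (All; []; _∷_)
  open import Data.Product using (_×_; _,_; proj₁; proj₂)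
  open import Relation.Binary.PropositionalEquality
  open import Data.Empty using (⊥-elim)
  open import Function using (_∘_)
  open import Data.Nat.Tactic.RingSolver using (solve-∀)

  elem-++ : ∀ a (v t : List ℕ) → elemᵇ a (v ++ t) ≡ elemᵇ a v ∨ elemᵇ a t
  elem-++ a []       t = refl
  elem-++ a (y ∷ ys) t = trans (cong ((a ≡ᵇ y) ∨_) (elem-++ a ys t)) (sym (∨-assoc (a ≡ᵇ y) (elemᵇ a ys) (elemᵇ a t)))

  distinct-++ : ∀ (v t : List ℕ) → distinctᵇ (v ++ t) ≡ true →
                (distinctᵇ v ≡ true) × (distinctᵇ t ≡ true) × (allᵇ (λ a → not (elemᵇ a t)) v ≡ true)
  distinct-++ []       t d = refl , d , refl
  distinct-++ (y ∷ ys) t d with distinct-++ ys t (∧-trueʳ {not (elemᵇ y (ys ++ t))} d)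
  ... | dv , dt , disjoint with ∨-false {elemᵇ y ys} (trans (sym (elem-++ y ys t)) (not-true (∧-trueˡ d)))
  ...   | y∉ys , y∉t = ∧-true (not-false y∉ys) dv , dt , ∧-true (not-false y∉t) disjoint

  take-++ : ∀ (v t : List ℕ) → take (length v) (v ++ t) ≡ v
  take-++ []       t = refl
  take-++ (y ∷ ys) t = cong (y ∷_) (take-++ ys t)

  drop-++ : ∀ (v t : List ℕ) → drop (length v) (v ++ t) ≡ t
  drop-++ []       t = refl
  drop-++ (y ∷ ys) t = drop-++ ys t

  present-letters : ∀ N (w : List ℕ) → distinctᵇ w ≡ true → All (_< N) w → Σl (λ a → ι (elemᵇ a w)) (upTo N) ≡ length w
  present-letters N []       _ _          = Σl-0 (upTo N)
  present-letters N (y ∷ ys) d (y<N ∷ ys<N) =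
    trans (Σl-cong (upTo N) split)
    (trans (Σl-+ (λ a → ι (a ≡ᵇ y) * 1) (λ a → ι (elemᵇ a ys)) (upTo N))
           (cong₂ _+_ (Σl-pick (λ _ → 1) y N y<N) (present-letters N ys (∧-trueʳ {not (elemᵇ y ys)} d) ys<N)))
    where
    split : ∀ a → ι ((a ≡ᵇ y) ∨ elemᵇ a ys) ≡ ι (a ≡ᵇ y) * 1 + ι (elemᵇ a ys)
    split a with a ≡ᵇ y in a≡y
    ... | false = refl
    ... | true rewrite ≡ᵇ-sound a y a≡y | not-true (∧-trueˡ {not (elemᵇ y ys)} d) = refl

  absent-letters : ∀ N (w : List ℕ) → distinctᵇ w ≡ true → All (_< N) w → Σl (λ a → ι (not (elemᵇ a w))) (upTo N) ≡ N ∸ length w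
  absent-letters N w d w<N = begin
      absent                                           ≡⟨ sym (m+n∸n≡m absent (length w)) ⟩
      absent + length w ∸ length w                     ≡⟨ cong (λ p → absent + p ∸ length w) (sym (present-letters N w d w<N)) ⟩
      absent + Σl (λ a → ι (elemᵇ a w)) (upTo N) ∸ length w ≡⟨ cong (_∸ length w) (sym (Σl-+ (λ a → ι (not (elemᵇ a w))) (λ a → ι (elemᵇ a w)) (upTo N))) ⟩
      Σl (λ a → ι (not (elemᵇ a w)) + ι (elemᵇ a w)) (upTo N) ∸ length w ≡⟨ cong (_∸ length w) (Σl-cong (upTo N) (λ a → ι-not (elemᵇ a w))) ⟩
      Σl (λ _ → 1) (upTo N) ∸ length w                ≡⟨ cong (_∸ length w) (Σl-upTo-const N) ⟩
      N ∸ length w                                     ∎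
    where
    open ≡-Reasoning
    absent : ℕ
    absent = Σl (λ a → ι (not (elemᵇ a w))) (upTo N)

  module Avoiders (s : ℕ) (σ' : List ℕ) where

    σ : List ℕ
    σ = s ∷ σ'

    m : ℕ
    m = length σ

    startsWith : List ℕ → Bool
    startsWith u = eqListᵇ (st (take m u)) σ

    good : List ℕ → Bool
    good u = distinctᵇ u ∧ not (containsᵇ σ u)

    contains-∷ : ∀ a w → containsᵇ σ (a ∷ w) ≡ startsWith (a ∷ w) ∨ containsᵇ σ w
    contains-∷ a w = cong (startsWith (a ∷ w) ∨_)
      (trans (cong (any p) (sym (map-upTo suc (suc (length w))))) (any-map p suc (upTo (suc (length w)))))
      where
      p : ℕ → Bool
      p i = eqListᵇ (st (take m (drop i (a ∷ w)))) σ
      any-map : (p : ℕ → Bool) (g : ℕ → ℕ) (xs : List ℕ) → any p (map g xs) ≡ any (p ∘ g) xs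
      any-map p g []       = refl
      any-map p g (x ∷ xs) = cong (p (g x) ∨_) (any-map p g xs)

    avoids-drop : ∀ i w → containsᵇ σ w ≡ false → containsᵇ σ (drop i w) ≡ false
    avoids-drop zero    w       e = e
    avoids-drop (suc i) []      e = e
    avoids-drop (suc i) (a ∷ w) e rewrite contains-∷ a w = avoids-drop i w (proj₂ (∨-false {startsWith (a ∷ w)} e))

    module Counts (N : ℕ) where

      avoiders : ℕ → ℕ
      avoiders k = Σl (λ u → ι (good u)) (words k N)

      blocked? : ℕ → List ℕ → Bool
      blocked? a w = good w ∧ (not (elemᵇ a w) ∧ startsWith (a ∷ w))

      blocked : ℕ → ℕ
      blocked k = Σl (λ w → Σl (λ a → ι (blocked? a w)) (upTo N)) (words k N)

      extension : ∀ a w → ι (good (a ∷ w)) + ι (blocked? a w) ≡ ι (good w) * ι (not (elemᵇ a w))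
      extension a w rewrite contains-∷ a w = table (elemᵇ a w) (distinctᵇ w) (startsWith (a ∷ w)) (containsᵇ σ w)
        where
        table : ∀ x d f c → ι ((not x ∧ d) ∧ not (f ∨ c)) + ι ((d ∧ not c) ∧ (not x ∧ f)) ≡ ι (d ∧ not c) * ι (not x)
        table true  true  true  true  = refl
        table true  true  true  false = refl
        table true  true  false true  = refl
        table true  true  false false = refl
        table true  false true  true  = refl
        table true  false true  false = refl
        table true  false false true  = refl
        table true  false false false = refl
        table false true  true  true  = refl
        table false true  true  false = refl
        table false true  false true  = refl
        table false true  false false = refl
        table false false true  true  = refl
        table false false true  false = refl
        table false false false true  = refl
        table false false false false = refl

      -- Each good word of length k has N - k extensions, each good or blocked.
      avoiders-suc : ∀ k → avoiders (suc k) + blocked k ≡ (N ∸ k) * avoiders k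
      avoiders-suc k = begin
          avoiders (suc k) + blocked k
        ≡⟨ cong (_+ blocked k) (Σl-words-suc (λ u → ι (good u)) k N) ⟩
          Σl (λ w → Σl (λ a → ι (good (a ∷ w))) (upTo N)) (words k N) + blocked k
        ≡⟨ sym (Σl-+ (λ w → Σl (λ a → ι (good (a ∷ w))) (upTo N)) (λ w → Σl (λ a → ι (blocked? a w)) (upTo N)) (words k N)) ⟩
          Σl (λ w → Σl (λ a → ι (good (a ∷ w))) (upTo N) + Σl (λ a → ι (blocked? a w)) (upTo N)) (words k N)
        ≡⟨ Σl-cong (words k N) (λ w → sym (Σl-+ (λ a → ι (good (a ∷ w))) (λ a → ι (blocked? a w)) (upTo N))) ⟩
          Σl (λ w → Σl (λ a → ι (good (a ∷ w)) + ι (blocked? a w)) (upTo N)) (words k N)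
        ≡⟨ Σl-cong (words k N) (λ w → trans (Σl-cong (upTo N) (λ a → extension a w)) (Σl-* (ι (good w)) (λ a → ι (not (elemᵇ a w))) (upTo N))) ⟩
          Σl (λ w → ι (good w) * Σl (λ a → ι (not (elemᵇ a w))) (upTo N)) (words k N)
        ≡⟨ Σl-cong-All (words-IsWord k N) unused ⟩
          Σl (λ w → (N ∸ k) * ι (good w)) (words k N)
        ≡⟨ Σl-* (N ∸ k) (λ u → ι (good u)) (words k N) ⟩
          (N ∸ k) * avoiders k ∎
        where
        open ≡-Reasoning
        unused : ∀ w → IsWord N k w → ι (good w) * Σl (λ a → ι (not (elemᵇ a w))) (upTo N) ≡ (N ∸ k) * ι (good w)
        unused w w-ok with good w in g
        ... | false = sym (*-zeroʳ (N ∸ k))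
        ... | true  = trans (+-identityʳ _) (trans (absent-letters N w (∧-trueˡ g) (proj₂ w-ok))
                            (trans (cong (N ∸_) (proj₁ w-ok)) (sym (*-identityʳ (N ∸ k)))))

      blocked-word : List ℕ → ℕ
      blocked-word []      = 0
      blocked-word (a ∷ w) = ι (blocked? a w)

      blocked-words : ∀ k → blocked k ≡ Σl blocked-word (words (suc k) N)
      blocked-words k = sym (Σl-words-suc blocked-word k N)

      blocked-short : ∀ k → suc k < m → blocked k ≡ 0
      blocked-short k k<m = trans (blocked-words k) (trans (Σl-cong-All (words-IsWord (suc k) N) none) (Σl-0 (words (suc k) N)))
        where
        none : ∀ u → IsWord N (suc k) u → blocked-word u ≡ 0
        none (a ∷ w) u-ok with startsWith (a ∷ w) in sw
        ... | false rewrite ∧-zeroʳ (not (elemᵇ a w)) | ∧-zeroʳ (good w) = refl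
        ... | true  = ⊥-elim (<-irrefl |st|≡m (subst (_< m) (sym |st|≡k+1) k<m))
          where
          |st|≡k+1 : length (st (take m (a ∷ w))) ≡ suc k
          |st|≡k+1 = trans (length-map _ (take m (a ∷ w)))
                           (trans (cong length (take-all m (a ∷ w) (subst (_≤ m) (sym (proj₁ u-ok)) (<⇒≤ k<m)))) (proj₁ u-ok))
          |st|≡m : length (st (take m (a ∷ w))) ≡ m
          |st|≡m = cong length (eqListᵇ-sound (st (take m (a ∷ w))) σ sw)

      -- Bound on blocked words via the pattern count: if k+1 = m + j, a blocked word of
      -- length k+1 is v ++ t with t good of length j and v a word with pattern σ avoiding t.
      starts-bound : List ℕ → ℕ
      starts-bound u = ι (distinctᵇ u ∧ (startsWith u ∧ not (containsᵇ σ (drop m u))))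

      blocked-word-starts : ∀ u → blocked-word u ≤ starts-bound u
      blocked-word-starts []      = z≤n
      blocked-word-starts (a ∷ w) with blocked? a w in b
      ... | false = z≤n
      ... | true  = ≤-reflexive (sym (cong ι starts))
        where
        w-good : good w ≡ true
        w-good = ∧-trueˡ b
        fresh : not (elemᵇ a w) ∧ startsWith (a ∷ w) ≡ true
        fresh = ∧-trueʳ {good w} b
        starts : distinctᵇ (a ∷ w) ∧ (startsWith (a ∷ w) ∧ not (containsᵇ σ (drop m (a ∷ w)))) ≡ true
        starts = ∧-true (∧-true (∧-trueˡ {not (elemᵇ a w)} fresh) (∧-trueˡ {distinctᵇ w} w-good))
                        (∧-true (∧-trueʳ {not (elemᵇ a w)} fresh)
                                (not-false (avoids-drop (length σ') w (not-true (∧-trueʳ {distinctᵇ w} w-good)))))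

      allowed-prefix : ∀ t v → All (_< N) v → allᵇ (λ a → not (elemᵇ a t)) v ≡ true → allᵇ (Fitting.allowed N t N) v ≡ true
      allowed-prefix t []      _          _  = refl
      allowed-prefix t (a ∷ w) (a<N ∷ w<N) ok =
        ∧-true (∧-true (<⇒<ᵇ-true a<N) (∧-trueˡ ok)) (allowed-prefix t w w<N (∧-trueʳ {not (elemᵇ a t)} ok))

      starts-split : ∀ v t → length v ≡ m → All (_< N) v → starts-bound (v ++ t) ≤ ι (good t) * ι (Fitting.fits N t N σ v)
      starts-split v t |v| v<N with distinctᵇ (v ++ t) ∧ (startsWith (v ++ t) ∧ not (containsᵇ σ (drop m (v ++ t)))) in s
      ... | false = z≤n
      ... | true  = ≤-reflexive (sym (cong₂ (λ x y → ι x * ι y) t-good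
                                            (∧-true (allowed-prefix t v v<N (proj₂ (proj₂ parts))) (∧-true (proj₁ parts) v-pattern))))
        where
        take-v : take m (v ++ t) ≡ v
        take-v = trans (cong (λ n → take n (v ++ t)) (sym |v|)) (take-++ v t)
        drop-v : drop m (v ++ t) ≡ t
        drop-v = trans (cong (λ n → drop n (v ++ t)) (sym |v|)) (drop-++ v t)
        parts : (distinctᵇ v ≡ true) × (distinctᵇ t ≡ true) × (allᵇ (λ a → not (elemᵇ a t)) v ≡ true)
        parts = distinct-++ v t (∧-trueˡ s)
        rest : startsWith (v ++ t) ∧ not (containsᵇ σ (drop m (v ++ t))) ≡ true
        rest = ∧-trueʳ {distinctᵇ (v ++ t)} s
        v-pattern : eqListᵇ (st v) σ ≡ true
        v-pattern = subst (λ z → eqListᵇ (st z) σ ≡ true) take-v (∧-trueˡ rest)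
        t-good : good t ≡ true
        t-good = ∧-true (proj₁ (proj₂ parts))
                        (not-false (subst (λ z → containsᵇ σ z ≡ false) drop-v (not-true (∧-trueʳ {startsWith (v ++ t)} rest))))

      blocked-bound : ∀ k j → suc k ≡ m + j → suc k ≤ N → distinctᵇ σ ≡ true → m ! * blocked k ≤ ((N ∸ j) P′ m) * avoiders j
      blocked-bound k j k+1≡m+j k<N distinct = begin
          m ! * blocked k
        ≡⟨ cong (m ! *_) (blocked-words k) ⟩
          m ! * Σl blocked-word (words (suc k) N)
        ≤⟨ *-monoʳ-≤ (m !) (Σl-mono (words (suc k) N) blocked-word-starts) ⟩
          m ! * Σl starts-bound (words (suc k) N)
        ≡⟨ cong (λ n → m ! * Σl starts-bound (words n N)) k+1≡m+j ⟩
          m ! * Σl starts-bound (words (m + j) N)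
        ≡⟨ cong (m ! *_) (Σl-words-++ starts-bound m j N) ⟩
          m ! * Σl (λ t → Σl (λ v → starts-bound (v ++ t)) (words m N)) (words j N)
        ≤⟨ *-monoʳ-≤ (m !) (Σl-mono (words j N) (λ t → Σl-mono-All (words-IsWord m N) (λ v v-ok → starts-split v t (proj₁ v-ok) (proj₂ v-ok)))) ⟩
          m ! * Σl (λ t → Σl (λ v → ι (good t) * ι (Fitting.fits N t N σ v)) (words m N)) (words j N)
        ≡⟨ cong (m ! *_) (Σl-cong (words j N) (λ t → Σl-* (ι (good t)) (λ v → ι (Fitting.fits N t N σ v)) (words m N))) ⟩
          m ! * Σl (λ t → ι (good t) * Fitting.count N t N m σ) (words j N)
        ≡⟨ sym (Σl-* (m !) (λ t → ι (good t) * Fitting.count N t N m σ) (words j N)) ⟩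
          Σl (λ t → m ! * (ι (good t) * Fitting.count N t N m σ)) (words j N)
        ≤⟨ Σl-mono-All (words-IsWord j N) per-suffix ⟩
          Σl (λ t → ((N ∸ j) P′ m) * ι (good t)) (words j N)
        ≡⟨ Σl-* ((N ∸ j) P′ m) (λ t → ι (good t)) (words j N) ⟩
          ((N ∸ j) P′ m) * avoiders j ∎
        where
        open ≤-Reasoning
        per-suffix : ∀ t → IsWord N j t → m ! * (ι (good t) * Fitting.count N t N m σ) ≤ ((N ∸ j) P′ m) * ι (good t)
        per-suffix t t-ok with good t in g
        ... | false = ≤-reflexive (trans (*-zeroʳ (m !)) (sym (*-zeroʳ ((N ∸ j) P′ m))))
        ... | true  = begin
            m ! * (1 * Fitting.count N t N m σ)  ≡⟨ cong (m ! *_) (*-identityˡ _) ⟩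
            m ! * Fitting.count N t N m σ        ≤⟨ Fitting.count-bound N t N ≤-refl m σ distinct ⟩
            Fitting.available N t N P′ m         ≡⟨ cong (_P′ m) (trans (absent-letters N t (∧-trueˡ g) (proj₂ t-ok)) (cong (N ∸_) (proj₁ t-ok))) ⟩
            (N ∸ j) P′ m                         ≡⟨ sym (*-identityʳ _) ⟩
            ((N ∸ j) P′ m) * 1                   ∎

      -- The weighted counts e k = avoiders k · (N-k)!, normalised so that e 0 = N! and
      -- e N = avoiders N; they stay constant while k+1 < m and otherwise satisfy
      -- m! e k ≤ m! e (k+1) + e j for k+1 = m + j.
      weighted : ℕ → ℕ
      weighted k = avoiders k * (N ∸ k) !

      weighted-start : weighted 0 ≡ N !
      weighted-start = +-identityʳ (N !)

      weighted-end : weighted N ≡ avoiders N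
      weighted-end rewrite n∸n≡0 N = *-identityʳ (avoiders N)

      factorial-peel : ∀ k → k < N → (N ∸ k) ! ≡ (N ∸ k) * (N ∸ suc k) !
      factorial-peel k k<N rewrite ∸-peel k<N = refl

      weighted-short : ∀ k → k < N → suc k < m → weighted (suc k) ≡ weighted k
      weighted-short k k<N k+1<m = begin
          avoiders (suc k) * (N ∸ suc k) !           ≡⟨ cong (_* (N ∸ suc k) !) unblocked ⟩
          (N ∸ k) * avoiders k * (N ∸ suc k) !       ≡⟨ regroup (N ∸ k) (avoiders k) ((N ∸ suc k) !) ⟩
          avoiders k * ((N ∸ k) * (N ∸ suc k) !)     ≡⟨ cong (avoiders k *_) (sym (factorial-peel k k<N)) ⟩
          avoiders k * (N ∸ k) !                     ∎
        where
        open ≡-Reasoning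
        regroup : ∀ a w f → (a * w) * f ≡ w * (a * f)
        regroup = solve-∀
        unblocked : avoiders (suc k) ≡ (N ∸ k) * avoiders k
        unblocked = trans (sym (+-identityʳ _)) (trans (cong (avoiders (suc k) +_) (sym (blocked-short k k+1<m))) (avoiders-suc k))

      weighted-long : ∀ k j → k < N → suc k ≡ m + j → distinctᵇ σ ≡ true → m ! * weighted k ≤ m ! * weighted (suc k) + weighted j
      weighted-long k j k<N k+1≡m+j distinct = begin
          m ! * (avoiders k * (N ∸ k) !)
        ≡⟨ cong (λ z → m ! * (avoiders k * z)) (factorial-peel k k<N) ⟩
          m ! * (avoiders k * ((N ∸ k) * F))
        ≡⟨ regroup (m !) (avoiders k) (N ∸ k) F ⟩
          (m ! * ((N ∸ k) * avoiders k)) * F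
        ≡⟨ cong (λ z → (m ! * z) * F) (sym (avoiders-suc k)) ⟩
          (m ! * (avoiders (suc k) + blocked k)) * F
        ≡⟨ cong (_* F) (*-distribˡ-+ (m !) (avoiders (suc k)) (blocked k)) ⟩
          (m ! * avoiders (suc k) + m ! * blocked k) * F
        ≤⟨ *-monoˡ-≤ F (+-monoʳ-≤ (m ! * avoiders (suc k)) (blocked-bound k j k+1≡m+j k<N distinct)) ⟩
          (m ! * avoiders (suc k) + ((N ∸ j) P′ m) * avoiders j) * F
        ≡⟨ distribute (m !) (avoiders (suc k)) (((N ∸ j) P′ m) * avoiders j) F ⟩
          m ! * (avoiders (suc k) * F) + ((N ∸ j) P′ m) * avoiders j * F
        ≡⟨ cong (m ! * (avoiders (suc k) * F) +_) suffix ⟩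
          m ! * weighted (suc k) + weighted j ∎
        where
        open ≤-Reasoning
        F : ℕ
        F = (N ∸ suc k) !
        regroup : ∀ M w a f → M * (w * (a * f)) ≡ (M * (a * w)) * f
        regroup = solve-∀
        distribute : ∀ M x y f → (M * x + y) * f ≡ M * (x * f) + y * f
        distribute = solve-∀
        m≤N∸j : m ≤ N ∸ j
        m≤N∸j = m+n≤o⇒m≤o∸n m (subst (_≤ N) k+1≡m+j k<N)
        N∸j∸m : N ∸ j ∸ m ≡ N ∸ suc k
        N∸j∸m = trans (∸-+-assoc N j m) (cong (N ∸_) (trans (+-comm j m) (sym k+1≡m+j)))
        suffix : ((N ∸ j) P′ m) * avoiders j * F ≡ avoiders j * (N ∸ j) !
        suffix = begin-equality
            ((N ∸ j) P′ m) * avoiders j * F         ≡⟨ cong (_* F) (*-comm ((N ∸ j) P′ m) (avoiders j)) ⟩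
            avoiders j * ((N ∸ j) P′ m) * F         ≡⟨ *-assoc (avoiders j) _ F ⟩
            avoiders j * (((N ∸ j) P′ m) * F)       ≡⟨ cong (λ z → avoiders j * (((N ∸ j) P′ m) * z !)) (sym N∸j∸m) ⟩
            avoiders j * (((N ∸ j) P′ m) * (N ∸ j ∸ m) !) ≡⟨ cong (avoiders j *_) (P′-factorial (N ∸ j) m m≤N∸j) ⟩
            avoiders j * (N ∸ j) !                  ∎

    α≡avoiders : ∀ n → α n σ ≡ Counts.avoiders n n
    α≡avoiders n = filter-filter distinctᵇ (λ π → not (containsᵇ σ π)) (words n n)
      where
      filter-filter : {A : Set} (p q : A → Bool) (xs : List A) → length (filterᵇ q (filterᵇ p xs)) ≡ Σl (λ x → ι (p x ∧ q x)) xs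
      filter-filter p q []       = refl
      filter-filter p q (x ∷ xs) with p x
      ... | false = filter-filter p q xs
      ... | true with q x
      ...   | true  = cong suc (filter-filter p q xs)
      ...   | false = filter-filter p q xs

module Rationals where

  open import Defs using (ℕ→ℚ; _^ℚ_)
  open import Data.Nat as ℕ using (ℕ; zero; suc)
  import Data.Nat.Properties as ℕP
  open import Data.Nat.Coprimality using (1-coprimeTo)
  import Data.Nat.Coprimality as Coprime
  open import Data.Integer as ℤ using (ℤ; +_)
  import Data.Integer.Properties as ℤP
  open import Data.Integer.Tactic.RingSolver as ℤ-Solver using ()
  open import Data.Rational
  open import Data.Rational.Properties
  open import Data.Rational.Unnormalised as ℚᵘ using (mkℚᵘ; *≡*)
  import Data.Rational.Unnormalised.Properties as ℚᵘP
  open import Data.Rational.Solver using (module +-*-Solver)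
  open +-*-Solver
  open import Relation.Binary.PropositionalEquality

  ℕ→ℚ-mkℚ : ∀ a → ℕ→ℚ a ≡ mkℚ (+ a) 0 (Coprime.sym (1-coprimeTo a))
  ℕ→ℚ-mkℚ a = ↥p/↧p≡p (mkℚ (+ a) 0 (Coprime.sym (1-coprimeTo a)))

  ℕ→ℚ-* : ∀ a b → ℕ→ℚ (a ℕ.* b) ≡ ℕ→ℚ a * ℕ→ℚ b
  ℕ→ℚ-* a b rewrite ℕ→ℚ-mkℚ a | ℕ→ℚ-mkℚ b = cong (_/ 1) (sym (ℤP.+◃n≡+n (a ℕ.* b)))

  ℕ→ℚ-+ : ∀ a b → ℕ→ℚ (a ℕ.+ b) ≡ ℕ→ℚ a + ℕ→ℚ b
  ℕ→ℚ-+ a b rewrite ℕ→ℚ-mkℚ a | ℕ→ℚ-mkℚ b =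
    cong (_/ 1) (sym (cong₂ ℤ._+_ (trans (ℤP.+◃n≡+n (a ℕ.* 1)) (cong +_ (ℕP.*-identityʳ a)))
                                  (trans (ℤP.+◃n≡+n (b ℕ.* 1)) (cong +_ (ℕP.*-identityʳ b)))))

  ℕ→ℚ-mono-≤ : ∀ {a b} → a ℕ.≤ b → ℕ→ℚ a ≤ ℕ→ℚ b
  ℕ→ℚ-mono-≤ {a} {b} a≤b rewrite ℕ→ℚ-mkℚ a | ℕ→ℚ-mkℚ b = *≤* (ℤP.*-monoʳ-≤-nonNeg (+ 1) (ℤ.+≤+ a≤b))

  ℕ→ℚ-mono-< : ∀ {a b} → a ℕ.< b → ℕ→ℚ a < ℕ→ℚ b
  ℕ→ℚ-mono-< {a} {b} a<b rewrite ℕ→ℚ-mkℚ a | ℕ→ℚ-mkℚ b = *<* (ℤP.*-monoʳ-<-pos (+ 1) (ℤ.+<+ a<b))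

  ℕ→ℚ-nonneg : ∀ a → 0ℚ ≤ ℕ→ℚ a
  ℕ→ℚ-nonneg a = ℕ→ℚ-mono-≤ {0} {a} ℕ.z≤n

  /-*-cancel : ∀ a d .{{_ : ℕ.NonZero d}} → ((+ a) / d) * ℕ→ℚ d ≡ ℕ→ℚ a
  /-*-cancel a (suc d) = toℚᵘ-injective (ℚᵘP.≃-trans (toℚᵘ-homo-* ((+ a) / suc d) (ℕ→ℚ (suc d)))
    (ℚᵘP.≃-trans (ℚᵘP.*-cong (toℚᵘ-fromℚᵘ (mkℚᵘ (+ a) d)) (toℚᵘ-fromℚᵘ (mkℚᵘ (+ suc d) 0)))
    (ℚᵘP.≃-trans (*≡* (reassoc (+ a) (+ suc d))) (ℚᵘP.≃-sym (toℚᵘ-fromℚᵘ (mkℚᵘ (+ a) 0))))))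
    where
    reassoc : ∀ (x y : ℤ) → (x ℤ.* y) ℤ.* (+ 1) ≡ x ℤ.* (y ℤ.* (+ 1))
    reassoc = ℤ-Solver.solve-∀

  mul-monoˡ : ∀ {p q} r → 0ℚ ≤ r → p ≤ q → r * p ≤ r * q
  mul-monoˡ r 0≤r = *-monoˡ-≤-nonNeg r {{nonNegative 0≤r}}

  mul-monoʳ : ∀ {p q} r → 0ℚ ≤ r → p ≤ q → p * r ≤ q * r
  mul-monoʳ r 0≤r = *-monoʳ-≤-nonNeg r {{nonNegative 0≤r}}

  mul-cancelˡ : ∀ {p q} r → 0ℚ < r → r * p ≤ r * q → p ≤ q
  mul-cancelˡ r 0<r = *-cancelˡ-≤-pos r {{positive 0<r}}

  mul-nonneg : ∀ {p q} → 0ℚ ≤ p → 0ℚ ≤ q → 0ℚ ≤ p * q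
  mul-nonneg {p} {q} 0≤p 0≤q = subst (_≤ p * q) (*-zeroʳ p) (mul-monoˡ p 0≤p 0≤q)

  mul-pos : ∀ {p q} → 0ℚ < p → 0ℚ < q → 0ℚ < p * q
  mul-pos {p} {q} 0<p 0<q = subst (_< p * q) (*-zeroʳ p) (*-monoʳ-<-pos p {{positive 0<p}} 0<q)

  add-nonneg : ∀ {p q} → 0ℚ ≤ p → 0ℚ ≤ q → 0ℚ ≤ p + q
  add-nonneg {p} {q} 0≤p 0≤q = subst (_≤ p + q) (+-identityˡ 0ℚ) (+-mono-≤ 0≤p 0≤q)

  add-pos : ∀ {p q} → 0ℚ < p → 0ℚ ≤ q → 0ℚ < p + q
  add-pos {p} {q} 0<p 0≤q = subst (_< p + q) (+-identityˡ 0ℚ) (+-mono-<-≤ 0<p 0≤q)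

  add-cancelʳ : ∀ {p q} r → p + r ≤ q + r → p ≤ q
  add-cancelʳ {p} {q} r le = subst₂ _≤_ (cancel p) (cancel q) (+-monoˡ-≤ (- r) le)
    where
    cancel : ∀ z → z + r + (- r) ≡ z
    cancel z = solve 2 (λ z r → z :+ r :+ (:- r) := z) refl z r

  ≤-from-diff : ∀ {p q} → 0ℚ ≤ q - p → p ≤ q
  ≤-from-diff {p} {q} h = subst₂ _≤_ (solve 1 (λ p → con 0ℚ :+ p := p) refl p) (solve 2 (λ p q → q :- p :+ p := q) refl p q) (+-monoˡ-≤ p h)

  <-from-diff : ∀ {p q} → 0ℚ < q - p → p < q
  <-from-diff {p} {q} h = subst₂ _<_ (solve 1 (λ p → con 0ℚ :+ p := p) refl p) (solve 2 (λ p q → q :- p :+ p := q) refl p q) (+-monoˡ-< p h)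

  diff-nonneg : ∀ {p q} → p ≤ q → 0ℚ ≤ q - p
  diff-nonneg {p} {q} h = subst₂ _≤_ (solve 1 (λ p → p :- p := con 0ℚ) refl p) refl (+-monoˡ-≤ (- p) h)

  pow-nonneg : ∀ {x} n → 0ℚ ≤ x → 0ℚ ≤ x ^ℚ n
  pow-nonneg zero    _   = *≤* (ℤ.+≤+ ℕ.z≤n)
  pow-nonneg (suc n) 0≤x = mul-nonneg 0≤x (pow-nonneg n 0≤x)

  pow-pos : ∀ {x} n → 0ℚ < x → 0ℚ < x ^ℚ n
  pow-pos zero    _   = *<* (ℤ.+<+ (ℕ.s≤s ℕ.z≤n))
  pow-pos (suc n) 0<x = mul-pos 0<x (pow-pos n 0<x)

  pow-mono-≤ : ∀ {q x} n → 0ℚ ≤ q → q ≤ x → q ^ℚ n ≤ x ^ℚ n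
  pow-mono-≤ zero    _   _   = ≤-refl
  pow-mono-≤ {q} {x} (suc n) 0≤q q≤x = ≤-trans (mul-monoʳ (q ^ℚ n) (pow-nonneg n 0≤q) q≤x)
                                               (mul-monoˡ x (≤-trans 0≤q q≤x) (pow-mono-≤ n 0≤q q≤x))

  pow-mono-< : ∀ {q x} n → 0ℚ < q → q < x → q ^ℚ suc n < x ^ℚ suc n
  pow-mono-< {q} {x} n 0<q q<x = <-≤-trans (*-monoˡ-<-pos (q ^ℚ n) {{positive (pow-pos n 0<q)}} q<x)
                                            (mul-monoˡ x (≤-trans (<⇒≤ 0<q) (<⇒≤ q<x)) (pow-mono-≤ n (<⇒≤ 0<q) (<⇒≤ q<x)))

  bernoulli : ∀ {x} n → 0ℚ ≤ x → x ≤ 1ℚ → 1ℚ - ℕ→ℚ n * (1ℚ - x) ≤ x ^ℚ n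
  bernoulli {x} zero    _   _   = ≤-reflexive (solve 1 (λ x → con 1ℚ :- con 0ℚ :* (con 1ℚ :- x) := con 1ℚ) refl x)
  bernoulli {x} (suc n) 0≤x x≤1 = begin
      1ℚ - ℕ→ℚ (suc n) * (1ℚ - x)
    ≡⟨ cong (λ z → 1ℚ - z * (1ℚ - x)) (ℕ→ℚ-+ 1 n) ⟩
      1ℚ - (1ℚ + n') * (1ℚ - x)
    ≡⟨ solve 2 (λ n' x → con 1ℚ :- (con 1ℚ :+ n') :* (con 1ℚ :- x) := con 1ℚ :- (con 1ℚ :+ n') :* (con 1ℚ :- x) :+ con 0ℚ) refl n' x ⟩
      1ℚ - (1ℚ + n') * (1ℚ - x) + 0ℚ
    ≤⟨ +-monoʳ-≤ (1ℚ - (1ℚ + n') * (1ℚ - x)) (mul-nonneg (mul-nonneg (ℕ→ℚ-nonneg n) 0≤1-x) 0≤1-x) ⟩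
      1ℚ - (1ℚ + n') * (1ℚ - x) + n' * (1ℚ - x) * (1ℚ - x)
    ≡⟨ solve 2 (λ n' x → con 1ℚ :- (con 1ℚ :+ n') :* (con 1ℚ :- x) :+ n' :* (con 1ℚ :- x) :* (con 1ℚ :- x) := x :* (con 1ℚ :- n' :* (con 1ℚ :- x))) refl n' x ⟩
      x * (1ℚ - n' * (1ℚ - x))
    ≤⟨ mul-monoˡ x 0≤x (bernoulli n 0≤x x≤1) ⟩
      x * x ^ℚ n ∎
    where
    open ≤-Reasoning
    n' : ℚ
    n' = ℕ→ℚ n
    0≤1-x : 0ℚ ≤ 1ℚ - x
    0≤1-x = diff-nonneg x≤1

module Growth where

  open import Defs using (ℕ→ℚ; _^ℚ_)
  open Rationals
  open import Data.Nat as ℕ using (ℕ; zero; suc)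
  import Data.Nat.Properties as ℕP
  open import Data.Rational
  open import Data.Rational.Properties
  open import Data.Rational.Solver using (module +-*-Solver)
  open +-*-Solver
  open import Data.Sum using (inj₁; inj₂)
  open import Relation.Nullary using (yes; no)
  open import Relation.Binary.PropositionalEquality

  ratio-step : ∀ (Ek Ek+1 Ej M y x : ℚ) → 0ℚ ≤ Ek → 0ℚ ≤ y → 0ℚ < M * y → 1ℚ ≤ M * y * (1ℚ - x) →
               y * Ej ≤ Ek → M * Ek ≤ M * Ek+1 + Ej → x * Ek ≤ Ek+1
  ratio-step Ek Ek+1 Ej M y x 0≤Ek 0≤y 0<c H yEj≤Ek recursion =
    mul-cancelˡ (M * y) 0<c (add-cancelʳ Ek (≤-trans lower upper))
    where
    open ≤-Reasoning
    c : ℚ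
    c = M * y
    lower : c * (x * Ek) + Ek ≤ y * (M * Ek)
    lower = begin
        c * (x * Ek) + Ek
      ≡⟨ solve 3 (λ c x Ek → c :* (x :* Ek) :+ Ek := c :* (x :* Ek) :+ Ek :* con 1ℚ) refl c x Ek ⟩
        c * (x * Ek) + Ek * 1ℚ
      ≤⟨ +-monoʳ-≤ (c * (x * Ek)) (mul-monoˡ Ek 0≤Ek H) ⟩
        c * (x * Ek) + Ek * (M * y * (1ℚ - x))
      ≡⟨ solve 4 (λ M y x Ek → M :* y :* (x :* Ek) :+ Ek :* (M :* y :* (con 1ℚ :- x)) := y :* (M :* Ek)) refl M y x Ek ⟩
        y * (M * Ek) ∎
    upper : y * (M * Ek) ≤ c * Ek+1 + Ek
    upper = begin
        y * (M * Ek)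
      ≤⟨ mul-monoˡ y 0≤y recursion ⟩
        y * (M * Ek+1 + Ej)
      ≡⟨ solve 4 (λ M y Ek+1 Ej → y :* (M :* Ek+1 :+ Ej) := M :* y :* Ek+1 :+ y :* Ej) refl M y Ek+1 Ej ⟩
        c * Ek+1 + y * Ej
      ≤⟨ +-monoʳ-≤ (c * Ek+1) yEj≤Ek ⟩
        c * Ek+1 + Ek ∎

  module GrowthLemma (N : ℕ) (e : ℕ → ℕ) (m' M : ℕ) (0<M : 0 ℕ.< M) (x : ℚ) (0<x : 0ℚ < x) (x≤1 : x ≤ 1ℚ)
    (H : 1ℚ ≤ ℕ→ℚ M * (x ^ℚ m') * (1ℚ - x))
    (flat : ∀ k → k ℕ.< N → suc k ℕ.< suc m' → e (suc k) ≡ e k)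
    (deficit : ∀ k j → k ℕ.< N → suc k ≡ suc m' ℕ.+ j → M ℕ.* e k ℕ.≤ M ℕ.* e (suc k) ℕ.+ e j) where

    E : ℕ → ℚ
    E k = ℕ→ℚ (e k)

    chain : ∀ d i → (∀ l → i ℕ.≤ l → l ℕ.< i ℕ.+ d → x * E l ≤ E (suc l)) → x ^ℚ d * E i ≤ E (i ℕ.+ d)
    chain zero    i _     = ≤-reflexive (trans (*-identityˡ (E i)) (cong E (sym (ℕP.+-identityʳ i))))
    chain (suc d) i ratio = begin
        x * x ^ℚ d * E i      ≡⟨ *-assoc x (x ^ℚ d) (E i) ⟩
        x * (x ^ℚ d * E i)    ≤⟨ mul-monoˡ x (<⇒≤ 0<x) (chain d i (λ l i≤l l<i+d → ratio l i≤l (ℕP.<-trans l<i+d i+d<i+d+1))) ⟩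
        x * E (i ℕ.+ d)       ≤⟨ ratio (i ℕ.+ d) (ℕP.m≤m+n i d) i+d<i+d+1 ⟩
        E (suc (i ℕ.+ d))     ≡⟨ cong E (sym (ℕP.+-suc i d)) ⟩
        E (i ℕ.+ suc d)       ∎
      where
      open ≤-Reasoning
      i+d<i+d+1 : i ℕ.+ d ℕ.< i ℕ.+ suc d
      i+d<i+d+1 = ℕP.+-monoʳ-< i (ℕP.n<1+n d)

    ratio-at : ∀ k → k ℕ.< N → (∀ l → l ℕ.< k → l ℕ.< N → x * E l ≤ E (suc l)) → x * E k ≤ E (suc k)
    ratio-at k k<N earlier with k ℕP.<? m'
    ... | yes k<m' = subst (x * E k ≤_) (cong ℕ→ℚ (sym (flat k k<N (ℕ.s≤s k<m'))))
                       (≤-trans (mul-monoʳ (E k) (ℕ→ℚ-nonneg (e k)) x≤1) (≤-reflexive (*-identityˡ (E k))))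
    ... | no k≮m' = ratio-step (E k) (E (suc k)) (E j) (ℕ→ℚ M) (x ^ℚ m') x (ℕ→ℚ-nonneg (e k)) (pow-nonneg m' (<⇒≤ 0<x))
                      (mul-pos (ℕ→ℚ-mono-< 0<M) (pow-pos m' 0<x)) H back recursion
      where
      j : ℕ
      j = k ℕ.∸ m'
      j+m'≡k : j ℕ.+ m' ≡ k
      j+m'≡k = ℕP.m∸n+n≡m (ℕP.≮⇒≥ k≮m')
      back : x ^ℚ m' * E j ≤ E k
      back = subst (λ z → x ^ℚ m' * E j ≤ E z) j+m'≡k
               (chain m' j (λ l _ l<k → earlier l (subst (l ℕ.<_) j+m'≡k l<k) (ℕP.<-trans (subst (l ℕ.<_) j+m'≡k l<k) k<N)))
      recursion : ℕ→ℚ M * E k ≤ ℕ→ℚ M * E (suc k) + E j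
      recursion = subst₂ _≤_ (ℕ→ℚ-* M (e k)) (trans (ℕ→ℚ-+ (M ℕ.* e (suc k)) (e j)) (cong (_+ E j) (ℕ→ℚ-* M (e (suc k)))))
                    (ℕ→ℚ-mono-≤ (deficit k j k<N (cong suc (trans (sym j+m'≡k) (ℕP.+-comm j m')))))

    ratio : ∀ k → (∀ l → l ℕ.< k → l ℕ.< N → x * E l ≤ E (suc l))
    ratio zero    l ()   _
    ratio (suc k) l l<k+1 l<N with ℕP.m≤n⇒m<n∨m≡n (ℕP.≤-pred l<k+1)
    ... | inj₁ l<k  = ratio k l l<k l<N
    ... | inj₂ refl = ratio-at l l<N (ratio l)

    growth : x ^ℚ N * E 0 ≤ E N
    growth = chain N 0 (λ l _ l<N → ratio N l l<N l<N)

module Estimates where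

  open import Defs using (ℕ→ℚ; _^ℚ_; bound)
  open Rationals
  open import Data.Nat as ℕ using (ℕ; suc; _!)
  import Data.Nat.Properties as ℕP
  open import Data.Integer as ℤ using (ℤ; +_)
  open import Data.Rational
  open import Data.Rational.Properties
  open import Data.Rational.Solver using (module +-*-Solver)
  open +-*-Solver
  import Data.Nat.Tactic.RingSolver as ℕ-Solver
  open import Data.Sum using (inj₁; inj₂)
  open import Data.Product using (Σ; _×_; _,_)
  open import Relation.Binary.PropositionalEquality
  open import Relation.Nullary.Decidable using (toWitness)
  open import Data.Unit using (tt)

  -- 8n ≤ (n+1)! for n ≥ 3, which keeps u = (m-1)/m! below 1/8 for m ≥ 4.
  8n≤[1+n]! : ∀ n → 3 ℕ.≤ n → 8 ℕ.* n ℕ.≤ suc n !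
  8n≤[1+n]! 1 (ℕ.s≤s ())
  8n≤[1+n]! 2 (ℕ.s≤s (ℕ.s≤s ()))
  8n≤[1+n]! 3 _ = ℕP.≤-refl
  8n≤[1+n]! (suc n@(suc (suc (suc k)))) _ = begin
      8 ℕ.* suc n                             ≤⟨ ℕP.m≤m+n (8 ℕ.* suc n) (8 ℕ.* (k ℕ.+ 2)) ⟩
      8 ℕ.* suc n ℕ.+ 8 ℕ.* (k ℕ.+ 2)         ≡⟨ double k ⟩
      2 ℕ.* (8 ℕ.* n)                         ≤⟨ ℕP.*-mono-≤ {2} {suc (suc n)} (ℕ.s≤s (ℕ.s≤s ℕ.z≤n)) (8n≤[1+n]! n (ℕ.s≤s (ℕ.s≤s (ℕ.s≤s ℕ.z≤n)))) ⟩
      suc (suc n) ℕ.* suc n !                 ∎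
    where
    open ℕP.≤-Reasoning
    double : ∀ k → 8 ℕ.* (4 ℕ.+ k) ℕ.+ 8 ℕ.* (k ℕ.+ 2) ≡ 2 ℕ.* (8 ℕ.* (3 ℕ.+ k))
    double = ℕ-Solver.solve-∀

  -- Fix m = m'+1 ≥ 4 and put P = 1/m!, u = (m-1)/m!, so that bound 16 m = 1 - P - 16uP.
  -- Every x in the window [1 - 4P, bound 16 m] satisfies 1 ≤ m!·x^(m-1)·(1-x): Bernoulli
  -- gives x^(m-1) ≥ 1 - 4u, 1 - x ≥ P(1 + 16u), and (1 - 4u)(1 + 16u) ≥ 1 since 8u ≤ 1.
  module Window (m' : ℕ) (3≤m' : 3 ℕ.≤ m') where

    m : ℕ
    m = suc m'
    M : ℚ
    M = ℕ→ℚ (m !)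
    P : ℚ
    P = ((+ 1) / (m !)) {{ℕP._!≢0 m}}
    U : ℚ
    U = ℕ→ℚ m'
    u : ℚ
    u = U * P
    upper : ℚ
    upper = bound (ℕ→ℚ 16) m
    R : ℚ
    R = ((+ m') / (m ! ℕ.* m !)) {{ℕP._!*_!≢0 m m}}

    P*M≡1 : P * M ≡ 1ℚ
    P*M≡1 = /-*-cancel 1 (m !) {{ℕP._!≢0 m}}

    R*M*M≡U : R * (M * M) ≡ U
    R*M*M≡U = trans (cong (R *_) (sym (ℕ→ℚ-* (m !) (m !)))) (/-*-cancel m' (m ! ℕ.* m !) {{ℕP._!*_!≢0 m m}})

    R≡uP : R ≡ u * P
    R≡uP = begin
        R
      ≡⟨ solve 1 (λ R → R := R :* con 1ℚ :* con 1ℚ) refl R ⟩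
        R * 1ℚ * 1ℚ
      ≡⟨ cong₂ (λ a c → R * a * c) (sym P*M≡1) (sym P*M≡1) ⟩
        R * (P * M) * (P * M)
      ≡⟨ solve 3 (λ R P M → R :* (P :* M) :* (P :* M) := R :* (M :* M) :* P :* P) refl R P M ⟩
        R * (M * M) * P * P
      ≡⟨ cong (λ z → z * P * P) R*M*M≡U ⟩
        U * P * P ∎
      where open ≡-Reasoning

    upper≡ : upper ≡ 1ℚ - P - ℕ→ℚ 16 * (u * P)
    upper≡ = cong (λ z → 1ℚ - P - ℕ→ℚ 16 * z) R≡uP

    0<P : 0ℚ < P
    0<P = positive⁻¹ P {{normalize-pos 1 (m !) {{ℕP._!≢0 m}}}}

    0≤M : 0ℚ ≤ M
    0≤M = ℕ→ℚ-nonneg (m !)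

    0≤u : 0ℚ ≤ u
    0≤u = mul-nonneg (ℕ→ℚ-nonneg m') (<⇒≤ 0<P)

    M*P≡1 : M * P ≡ 1ℚ
    M*P≡1 = trans (*-comm M P) P*M≡1

    8u≤1 : ℕ→ℚ 8 * u ≤ 1ℚ
    8u≤1 = begin
        ℕ→ℚ 8 * (U * P)
      ≡⟨ sym (*-assoc (ℕ→ℚ 8) U P) ⟩
        ℕ→ℚ 8 * U * P
      ≡⟨ cong (_* P) (sym (ℕ→ℚ-* 8 m')) ⟩
        ℕ→ℚ (8 ℕ.* m') * P
      ≤⟨ mul-monoʳ P (<⇒≤ 0<P) (ℕ→ℚ-mono-≤ (8n≤[1+n]! m' 3≤m')) ⟩
        M * P
      ≡⟨ M*P≡1 ⟩
        1ℚ ∎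
      where open ≤-Reasoning

    8P≤1 : ℕ→ℚ 8 * P ≤ 1ℚ
    8P≤1 = begin
        ℕ→ℚ 8 * P
      ≤⟨ mul-monoʳ P (<⇒≤ 0<P) (ℕ→ℚ-mono-≤ (ℕP.≤-trans (ℕP.*-monoʳ-≤ 8 (ℕP.≤-trans (ℕ.s≤s ℕ.z≤n) 3≤m')) (8n≤[1+n]! m' 3≤m'))) ⟩
        M * P
      ≡⟨ M*P≡1 ⟩
        1ℚ ∎
      where open ≤-Reasoning

    lower : ℚ
    lower = 1ℚ - ℕ→ℚ 4 * P

    0≤1-8u : 0ℚ ≤ 1ℚ - ℕ→ℚ 8 * u
    0≤1-8u = diff-nonneg 8u≤1

    lower<upper : lower < upper
    lower<upper = <-from-diff (subst (0ℚ <_) identity (mul-pos 0<P (add-pos {1ℚ} (*<* (ℤ.+<+ (ℕ.s≤s ℕ.z≤n))) (mul-nonneg (ℕ→ℚ-nonneg 2) 0≤1-8u))))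
      where
      identity : P * (1ℚ + ℕ→ℚ 2 * (1ℚ - ℕ→ℚ 8 * u)) ≡ upper - lower
      identity = trans (solve 2 (λ P u → P :* (con 1ℚ :+ con (ℕ→ℚ 2) :* (con 1ℚ :- con (ℕ→ℚ 8) :* u))
                                := con 1ℚ :- P :- con (ℕ→ℚ 16) :* (u :* P) :- (con 1ℚ :- con (ℕ→ℚ 4) :* P)) refl P u)
                  (cong (_- lower) (sym upper≡))

    0<lower : 0ℚ < lower
    0<lower = subst (0ℚ <_) identity (add-pos (mul-pos (ℕ→ℚ-mono-< {0} {4} (ℕ.s≤s ℕ.z≤n)) 0<P) (diff-nonneg 8P≤1))
      where
      identity : ℕ→ℚ 4 * P + (1ℚ - ℕ→ℚ 8 * P) ≡ lower
      identity = solve 1 (λ P → con (ℕ→ℚ 4) :* P :+ (con 1ℚ :- con (ℕ→ℚ 8) :* P) := con 1ℚ :- con (ℕ→ℚ 4) :* P) refl P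

    upper≤1 : upper ≤ 1ℚ
    upper≤1 = ≤-from-diff (subst (0ℚ ≤_) identity (add-nonneg (<⇒≤ 0<P) (mul-nonneg (ℕ→ℚ-nonneg 16) (mul-nonneg 0≤u (<⇒≤ 0<P)))))
      where
      identity : P + ℕ→ℚ 16 * (u * P) ≡ 1ℚ - upper
      identity = trans (solve 2 (λ P u → P :+ con (ℕ→ℚ 16) :* (u :* P) := con 1ℚ :- (con 1ℚ :- P :- con (ℕ→ℚ 16) :* (u :* P))) refl P u)
                  (cong (λ z → 1ℚ - z) (sym upper≡))

    window-condition : ∀ x → x ≤ upper → lower ≤ x → 1ℚ ≤ M * (x ^ℚ m') * (1ℚ - x)
    window-condition x x≤upper lower≤x = begin
        1ℚ
      ≤⟨ ≤-from-diff (subst (0ℚ ≤_) expand (mul-nonneg (mul-nonneg (ℕ→ℚ-nonneg 4) 0≤u) (add-nonneg {1ℚ} (*≤* (ℤ.+≤+ ℕ.z≤n)) (mul-nonneg (ℕ→ℚ-nonneg 2) 0≤1-8u)))) ⟩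
        z * (1ℚ + ℕ→ℚ 16 * u)
      ≡⟨ sym (*-identityʳ _) ⟩
        z * (1ℚ + ℕ→ℚ 16 * u) * 1ℚ
      ≡⟨ cong (λ t → z * (1ℚ + ℕ→ℚ 16 * u) * t) (sym M*P≡1) ⟩
        z * (1ℚ + ℕ→ℚ 16 * u) * (M * P)
      ≡⟨ solve 4 (λ z u M P → z :* (con 1ℚ :+ con (ℕ→ℚ 16) :* u) :* (M :* P) := M :* z :* (P :+ con (ℕ→ℚ 16) :* (u :* P))) refl z u M P ⟩
        M * z * L
      ≤⟨ mul-monoʳ L 0≤L (mul-monoˡ M 0≤M z≤x^m') ⟩
        M * (x ^ℚ m') * L
      ≤⟨ mul-monoˡ (M * (x ^ℚ m')) (mul-nonneg 0≤M (pow-nonneg m' 0≤x)) L≤1-x ⟩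
        M * (x ^ℚ m') * (1ℚ - x) ∎
      where
      open ≤-Reasoning
      0≤x : 0ℚ ≤ x
      0≤x = ≤-trans (<⇒≤ 0<lower) lower≤x
      x≤1 : x ≤ 1ℚ
      x≤1 = ≤-trans x≤upper upper≤1
      L : ℚ
      L = P + ℕ→ℚ 16 * (u * P)
      0≤L : 0ℚ ≤ L
      0≤L = add-nonneg (<⇒≤ 0<P) (mul-nonneg (ℕ→ℚ-nonneg 16) (mul-nonneg 0≤u (<⇒≤ 0<P)))
      L≤1-x : L ≤ 1ℚ - x
      L≤1-x = ≤-from-diff (subst (0ℚ ≤_) identity (diff-nonneg x≤upper))
        where
        identity : upper - x ≡ (1ℚ - x) - L
        identity = trans (cong (_- x) upper≡) (solve 3 (λ P u x → con 1ℚ :- P :- con (ℕ→ℚ 16) :* (u :* P) :- x := (con 1ℚ :- x) :- (P :+ con (ℕ→ℚ 16) :* (u :* P))) refl P u x)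
      1-x≤4P : 1ℚ - x ≤ ℕ→ℚ 4 * P
      1-x≤4P = ≤-from-diff (subst (0ℚ ≤_) identity (diff-nonneg lower≤x))
        where
        identity : x - lower ≡ ℕ→ℚ 4 * P - (1ℚ - x)
        identity = solve 2 (λ x P → x :- (con 1ℚ :- con (ℕ→ℚ 4) :* P) := con (ℕ→ℚ 4) :* P :- (con 1ℚ :- x)) refl x P
      z : ℚ
      z = 1ℚ - ℕ→ℚ 4 * u
      z≤x^m' : z ≤ x ^ℚ m'
      z≤x^m' = ≤-trans (≤-from-diff (subst (0ℚ ≤_) identity (mul-nonneg (ℕ→ℚ-nonneg m') (diff-nonneg 1-x≤4P)))) (bernoulli m' 0≤x x≤1)
        where
        identity : U * (ℕ→ℚ 4 * P - (1ℚ - x)) ≡ (1ℚ - U * (1ℚ - x)) - z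
        identity = solve 3 (λ U P x → U :* (con (ℕ→ℚ 4) :* P :- (con 1ℚ :- x)) := (con 1ℚ :- U :* (con 1ℚ :- x)) :- (con 1ℚ :- con (ℕ→ℚ 4) :* (U :* P))) refl U P x
      expand : ℕ→ℚ 4 * u * (1ℚ + ℕ→ℚ 2 * (1ℚ - ℕ→ℚ 8 * u)) ≡ z * (1ℚ + ℕ→ℚ 16 * u) - 1ℚ
      expand = solve 1 (λ u → con (ℕ→ℚ 4) :* u :* (con 1ℚ :+ con (ℕ→ℚ 2) :* (con 1ℚ :- con (ℕ→ℚ 8) :* u)) := (con 1ℚ :- con (ℕ→ℚ 4) :* u) :* (con 1ℚ :+ con (ℕ→ℚ 16) :* u) :- con 1ℚ) refl u

    admissible : ∀ q → q < upper →
                 Σ ℚ λ x → (q < x) × (0ℚ < x) × (x ≤ 1ℚ) × (1ℚ ≤ M * (x ^ℚ m') * (1ℚ - x))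
    admissible q q<upper with <-dense q<upper
    ... | q' , q<q' , q'<upper with ≤-total q' lower
    ...   | inj₁ q'≤lower = lower , <-≤-trans q<q' q'≤lower , 0<lower , ≤-trans (<⇒≤ lower<upper) upper≤1
                          , window-condition lower (<⇒≤ lower<upper) ≤-refl
    ...   | inj₂ lower≤q' = q' , q<q' , <-≤-trans 0<lower lower≤q' , ≤-trans (<⇒≤ q'<upper) upper≤1
                          , window-condition q' (<⇒≤ q'<upper) lower≤q'

  bound-small : ∀ m → 1 ℕ.≤ m → m ℕ.≤ 3 → bound (ℕ→ℚ 16) m ≤ 0ℚ
  bound-small 1 _ _ = toWitness {a? = bound (ℕ→ℚ 16) 1 ≤? 0ℚ} tt
  bound-small 2 _ _ = toWitness {a? = bound (ℕ→ℚ 16) 2 ≤? 0ℚ} tt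
  bound-small 3 _ _ = toWitness {a? = bound (ℕ→ℚ 16) 3 ≤? 0ℚ} tt
  bound-small (suc (suc (suc (suc _)))) _ (ℕ.s≤s (ℕ.s≤s (ℕ.s≤s ())))


open import Defs
open Words
open Recurrence
open Rationals
open Growth
open Estimates
open import Data.Bool using (true; T)
open import Data.Nat as ℕ using (ℕ; suc; _!)
import Data.Nat.Properties as ℕP
open import Data.List using (List; []; _∷_; length)
open import Data.List.Membership.Propositional using (_∈_)
open import Data.List.Membership.Propositional.Properties using (∈-filter⁻)
import Data.List.Relation.Unary.All as All
open import Data.Rational
open import Data.Rational.Properties
open import Data.Product using (Σ; _×_; _,_; proj₁)
open import Relation.Binary.PropositionalEquality
open import Relation.Nullary using (Dec; yes; no)
open import Relation.Nullary.Decidable.Core using (T?)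
open import Function using (_∘_)
open import Data.Empty using (⊥-elim)

S-member : ∀ m σ → σ ∈ S m → (distinctᵇ σ ≡ true) × (length σ ≡ m)
S-member m σ σ∈S with ∈-filter⁻ (T? ∘ distinctᵇ) {xs = words m m} σ∈S
... | σ∈words , distinct = T⇒true distinct , proj₁ (All.lookup (words-IsWord m m) σ∈words)
  where
  T⇒true : ∀ {b} → T b → b ≡ true
  T⇒true {true} _ = refl

α-lower-bound : ∀ s σ' (x : ℚ) → distinctᵇ (s ∷ σ') ≡ true → 0ℚ < x → x ≤ 1ℚ →
                1ℚ ≤ ℕ→ℚ (suc (length σ') !) * (x ^ℚ length σ') * (1ℚ - x) →
                ∀ n → x ^ℚ n * ℕ→ℚ (n !) ≤ ℕ→ℚ (α n (s ∷ σ'))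
α-lower-bound s σ' x distinct 0<x x≤1 H n =
  subst₂ (λ a b → x ^ℚ n * ℕ→ℚ a ≤ ℕ→ℚ b) weighted-start (trans weighted-end (sym (α≡avoiders n))) growth
  where
  open Avoiders s σ'
  open Counts n
  open GrowthLemma n weighted (length σ') (suc (length σ') !) (ℕ.>-nonZero⁻¹ _ {{ℕP._!≢0 (suc (length σ'))}}) x 0<x x≤1 H
         weighted-short (λ k j k<n k+1≡m+j → weighted-long k j k<n k+1≡m+j distinct)

-- For m ≥ 4 the growth rate exceeds every q below the bound: pick an admissible x > q,
-- then q^n·n! < x^n·n! ≤ α_n(σ) for all n ≥ 1.
growth-rate-large : ∀ s σ' → distinctᵇ (s ∷ σ') ≡ true → 3 ℕ.≤ length σ' → ρ≥ (s ∷ σ') (bound (ℕ→ℚ 16) (suc (length σ')))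
growth-rate-large s σ' distinct 3≤m' q 0<q q<bound = 1 , beaten (Window.admissible (length σ') 3≤m' q q<bound)
  where
  beaten : (Σ ℚ λ x → (q < x) × (0ℚ < x) × (x ≤ 1ℚ) × (1ℚ ≤ ℕ→ℚ (suc (length σ') !) * (x ^ℚ length σ') * (1ℚ - x))) →
           ∀ n → 1 ℕ.≤ n → (q ^ℚ n) * ℕ→ℚ (n !) < ℕ→ℚ (α n (s ∷ σ'))
  beaten (x , q<x , 0<x , x≤1 , H) (suc n) _ = begin-strict
      q ^ℚ suc n * ℕ→ℚ (suc n !)   <⟨ *-monoˡ-<-pos (ℕ→ℚ (suc n !)) {{positive 0<[1+n]!}} (pow-mono-< n 0<q q<x) ⟩
      x ^ℚ suc n * ℕ→ℚ (suc n !)   ≤⟨ α-lower-bound s σ' x distinct 0<x x≤1 H (suc n) ⟩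
      ℕ→ℚ (α (suc n) (s ∷ σ'))     ∎
    where
    open ≤-Reasoning
    0<[1+n]! : 0ℚ < ℕ→ℚ (suc n !)
    0<[1+n]! = ℕ→ℚ-mono-< (ℕ.>-nonZero⁻¹ (suc n !) {{ℕP._!≢0 (suc n)}})

growth-rate-small : ∀ m σ → 1 ℕ.≤ m → m ℕ.≤ 3 → ρ≥ σ (bound (ℕ→ℚ 16) m)
growth-rate-small m σ 1≤m m≤3 q 0<q q<bound =
  ⊥-elim (<-irrefl refl (<-≤-trans 0<q (≤-trans (<⇒≤ q<bound) (bound-small m 1≤m m≤3))))

theorem2 : Σ ℚ (λ C → 0ℚ < C × ((m : ℕ) → 1 ℕ.≤ m → (σ : List ℕ) → σ ∈ S m → ρ≥ σ (bound C m)))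
theorem2 = ℕ→ℚ 16 , ℕ→ℚ-mono-< {0} {16} (ℕ.s≤s ℕ.z≤n) ,
           λ m 1≤m σ σ∈S → growth-rate m 1≤m (m ℕP.≤? 3) σ (S-member m σ σ∈S)
  where
  growth-rate : ∀ m → 1 ℕ.≤ m → Dec (m ℕ.≤ 3) → ∀ σ → (distinctᵇ σ ≡ true) × (length σ ≡ m) → ρ≥ σ (bound (ℕ→ℚ 16) m)
  growth-rate m 1≤m (yes m≤3) σ _ = growth-rate-small m σ 1≤m m≤3
  growth-rate .0 () (no _) [] (_ , refl)
  growth-rate .(suc (length σ')) _ (no m≰3) (s ∷ σ') (distinct , refl) =
    growth-rate-large s σ' distinct (ℕP.≤-pred (ℕP.≰⇒> m≰3))
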